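{- For integers $n\geqslant 0$ and $s\geqslant -1$, let $\mathfrak a_{n,s}$ be the number of sequences $\sigma\in\mathbb N^n$ with $\sigma_i<i+s$ for all $i\in\{1,\dots,n\}$ which avoid both $010$ and $102$. For $n,k\geqslant 0$, let $\mathfrak b_{n,k}$ be the number of words of length $n$ over $\{0,\dots,k-1\}$ avoiding $010$ and $102$ whose maximum letter is $k-1$. Then for all $n\geqslant 1$, $s\geqslant 0$, $$\mathfrak a_{n,s}=\sum_{z=0}^{n}\mathfrak a_{n-z,s+z-1}+\sum_{z=1}^{n-1}\mathfrak a_{n-z,s-1}+\sum_{r=1}^{n-2}\sum_{m=1}^{s}\mathfrak b_{r,m}\sum_{\ell=0}^{n-r-1}\big(n-r-\ell-\delta_{\ell,0}\big)\,\mathfrak a_{\ell,s-m-1},$$ where $\delta$ is the Kronecker delta.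
   Context: An integer sequence contains a pattern $\rho$ (a finite integer sequence such as $010$ or $102$) if it has a subsequence order-isomorphic to $\rho$, and avoids $\rho$ otherwise. Sequences $\sigma\in\mathbb N^n$ with $\sigma_i<i+s$ for all $i$ are called $s$-shifted inversion sequences; for $s=0$ these are the inversion sequences, so $\mathfrak a_{n,0}$ counts inversion sequences of size $n$ avoiding $010$ and $102$. For $s=-1$ the definition gives $\mathfrak a_{0,-1}=1$ and $\mathfrak a_{n,-1}=0$ for $n\geqslant1$. -}

module Defs where

open import Data.Bool using (Bool; true; false; _∧_; not)
open import Data.Nat using (ℕ; zero; suc; _+_; _*_; _∸_; _<ᵇ_; _≡ᵇ_)
open import Data.Integer as ℤ using (ℤ; 0ℤ)
open import Data.List using (List; []; _∷_; [_]; _++_; map; concatMap; upTo; applyUpTo; length; filterᵇ)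
open import Data.Bool.ListAction using (any)
open import Data.Nat.ListAction using (sum)

_==_ : Bool → Bool → Bool
true  == b = b
false == b = not b

subseqs : ℕ → List ℕ → List (List ℕ)
subseqs zero    _        = [ [] ]
subseqs (suc k) []       = []
subseqs (suc k) (x ∷ xs) = map (x ∷_) (subseqs k xs) ++ subseqs (suc k) xs

sameCmp : ℕ → ℕ → ℕ → ℕ → Bool
sameCmp x y x' y' = ((x <ᵇ y) == (x' <ᵇ y')) ∧ ((x ≡ᵇ y) == (x' ≡ᵇ y')) ∧ ((y <ᵇ x) == (y' <ᵇ x'))

headCmp : ℕ → List ℕ → ℕ → List ℕ → Bool
headCmp x []       y []       = true
headCmp x (u ∷ us) y (v ∷ vs) = sameCmp x u y v ∧ headCmp x us y vs
headCmp x _        y _        = false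

orderIso : List ℕ → List ℕ → Bool
orderIso []       []       = true
orderIso (x ∷ xs) (y ∷ ys) = headCmp x xs y ys ∧ orderIso xs ys
orderIso _        _        = false

contains : List ℕ → List ℕ → Bool
contains σ ρ = any (orderIso ρ) (subseqs (length ρ) σ)

avoids : List ℕ → List ℕ → Bool
avoids σ ρ = not (contains σ ρ)

p010 : List ℕ
p010 = 0 ∷ 1 ∷ 0 ∷ []

p102 : List ℕ
p102 = 1 ∷ 0 ∷ 2 ∷ []

avoidsBoth : List ℕ → Bool
avoidsBoth σ = avoids σ p010 ∧ avoids σ p102

nVals : ℕ → ℤ → ℕ
nVals i s = ℤ.∣ ((ℤ.+ i) ℤ.+ s) ℤ.⊔ 0ℤ ∣

-- all s-shifted sequences σ ∈ ℕ^n, i.e. σ_i < i + s for i = 1..n (each listed once)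
shiftedSeqs : ℕ → ℤ → List (List ℕ)
shiftedSeqs zero    s = [ [] ]
shiftedSeqs (suc n) s =
  concatMap (λ σ → map (λ v → σ ++ [ v ]) (upTo (nVals (suc n) s))) (shiftedSeqs n s)

𝔞 : ℕ → ℤ → ℕ
𝔞 n s = length (filterᵇ avoidsBoth (shiftedSeqs n s))

words : ℕ → ℕ → List (List ℕ)
words zero    k = [ [] ]
words (suc n) k = concatMap (λ w → map (λ v → v ∷ w) (upTo k)) (words n k)

-- maximum letter of a (nonempty) word equals k-1: letter k-1 occurs (all letters are < k)
hasMax : ℕ → List ℕ → Bool
hasMax k w = any (λ x → x ≡ᵇ (k ∸ 1)) w

𝔟 : ℕ → ℕ → ℕ
𝔟 n k = length (filterᵇ (λ w → avoidsBoth w ∧ hasMax k w) (words n k))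

-- Σ_{i=a}^{b} f i  (empty if b < a)
sumFT : ℕ → ℕ → (ℕ → ℕ) → ℕ
sumFT a b f = sum (map f (applyUpTo (λ i → a + i) (suc b ∸ a)))

δ : ℕ → ℕ → ℕ
δ zero    zero    = 1
δ zero    (suc _) = 0
δ (suc _) zero    = 0
δ (suc m) (suc n) = δ m n

-- Avoiders σ without a zero are, after lowering every letter by one, the avoiders for shift s - 1:
-- the term z = 0 of the first sum. Otherwise cut σ = α 0 γ at its first zero. If α is empty then
-- σ = 0^z τ with τ positive, since a zero after a positive letter would complete a 010, and lowering
-- τ gives the other terms of the first sum. If α is not empty, 102 forces γ below the first letter
-- of α and 010 forces γ = 0^j β with β positive. For β empty this is the second sum. Otherwise, with
-- m = max β, σ avoids both patterns exactly when α and β do and α = α' m ⋯ m with α' above m (else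
-- some a < a' in α with a a letter of β gives a 010). Lowering β by one is counted by 𝔟_{r,m},
-- lowering α' by m + 1 by 𝔞_{ℓ,s-m-1}, and n - r - ℓ - δ_{ℓ,0} counts the lengths of the blocks.
module Submission where

open import Defs
open import Data.Nat
  using (ℕ; zero; suc; _+_; _*_; _∸_; _≥_; _≤_; _<_; z≤n; s≤s; z<s; _<ᵇ_; _≤ᵇ_; _≡ᵇ_; _⊔_; _≤?_; _<?_; _≟_)
open import Data.Integer as ℤ using (ℤ; +_; 0ℤ)
open import Relation.Binary.PropositionalEquality
  using (_≡_; _≢_; refl; sym; trans; cong; cong₂; subst; ≢-sym; module ≡-Reasoning)

open import Data.Bool using (Bool; true; false; _∧_; not; T)
open import Data.Bool.ListAction using (all; any)
open import Data.Bool.Properties using (∧-zeroʳ; ∧-comm)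
import Data.Integer.Properties as ℤₚ
open import Data.List using (List; []; _∷_; [_]; _++_; map; concatMap; upTo; applyUpTo; length; filterᵇ)
open import Data.List.Extrema.Nat using (max; xs≤max; max≤v⁺; max<v⁺; max≈v⁺; argmax-sel)
open import Data.List.Membership.Propositional using (_∈_)
open import Data.List.Properties using (map-++)
open import Data.List.Relation.Unary.All as All using (All; []; _∷_)
open import Data.List.Relation.Unary.All.Properties using (++⁺; ++⁻; ¬Any⇒All¬; All¬⇒¬Any)
  renaming (map⁺ to All-map⁺; map⁻ to All-map⁻)
open import Data.List.Relation.Unary.AllPairs as AllPairs using (AllPairs; []; _∷_)
open import Data.List.Relation.Unary.AllPairs.Properties using ()
  renaming (++⁺ to AllPairs-++⁺; map⁺ to AllPairs-map⁺; map⁻ to AllPairs-map⁻)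
open import Data.List.Relation.Unary.Any as Any using (Any; here; there)
open import Data.List.Relation.Unary.Any.Properties using () renaming (map⁺ to Any-map⁺; map⁻ to Any-map⁻)
open import Data.Nat.ListAction using (sum)
open import Data.Nat.ListAction.Properties using (sum-++)
open import Data.Nat.Properties
open import Algebra.Properties.CommutativeSemigroup +-commutativeSemigroup using (interchange; x∙yz≈y∙xz)
open import Algebra.Properties.CommutativeSemigroup *-commutativeSemigroup using ()
  renaming (x∙yz≈y∙xz to x*yz≡y*xz; x∙yz≈z∙xy to x*yz≡z*xy)
open import Data.Nat.Tactic.RingSolver using (solve-∀)
open import Data.Product using (Σ; _×_; _,_; proj₁; proj₂)
open import Data.Sum using (_⊎_; inj₁; inj₂; [_,_]′)
open import Data.Unit using (⊤; tt)
open import Function using (_∘_; id)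
open import Function.Bundles using (_⇔_; mk⇔; Equivalence)
open import Relation.Binary.Definitions using (tri<; tri≈; tri>)
open import Relation.Nullary.Decidable using (Dec; does; proof; _×-dec_; ¬?)
open import Relation.Nullary.Negation using (¬_; contradiction)
open import Relation.Nullary.Reflects
  using (Reflects; ofʸ; ofⁿ; det; T-reflects; ¬-reflects; _×-reflects_; _⊎-reflects_; fromEquivalence)

open Equivalence using (to; from)

-- Finite sums

𝟙 : Bool → ℕ
𝟙 true  = 1
𝟙 false = 0

𝟙-∧ : ∀ a b → 𝟙 (a ∧ b) ≡ 𝟙 a * 𝟙 b
𝟙-∧ true  b = sym (+-identityʳ (𝟙 b))
𝟙-∧ false b = refl

𝟙-split : ∀ b x → x ≡ 𝟙 b * x + 𝟙 (not b) * x
𝟙-split true  x = sym (trans (+-identityʳ _) (+-identityʳ x))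
𝟙-split false x = sym (+-identityʳ x)

𝟙-implied : ∀ a b → (T a → T b) → 𝟙 a ≡ 𝟙 b * 𝟙 a
𝟙-implied true  b a⇒b with b | a⇒b tt
... | true | _ = refl
𝟙-implied false b _ = sym (*-zeroʳ (𝟙 b))

∑ : ℕ → (ℕ → ℕ) → ℕ
∑ zero    f = 0
∑ (suc n) f = f 0 + ∑ n (f ∘ suc)

∑-cong : ∀ n {f g : ℕ → ℕ} → (∀ i → i < n → f i ≡ g i) → ∑ n f ≡ ∑ n g
∑-cong zero    _   = refl
∑-cong (suc n) f≗g = cong₂ _+_ (f≗g 0 (s≤s z≤n)) (∑-cong n (λ i i<n → f≗g (suc i) (s≤s i<n)))

∑-zero : ∀ n → ∑ n (λ _ → 0) ≡ 0
∑-zero zero    = refl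
∑-zero (suc n) = ∑-zero n

∑-distrib-+ : ∀ n (f g : ℕ → ℕ) → ∑ n (λ i → f i + g i) ≡ ∑ n f + ∑ n g
∑-distrib-+ zero    f g = refl
∑-distrib-+ (suc n) f g rewrite ∑-distrib-+ n (f ∘ suc) (g ∘ suc) = interchange (f 0) (g 0) _ _

∑-*ˡ : ∀ n c (f : ℕ → ℕ) → ∑ n (λ i → c * f i) ≡ c * ∑ n f
∑-*ˡ zero    c f = sym (*-zeroʳ c)
∑-*ˡ (suc n) c f rewrite ∑-*ˡ n c (f ∘ suc) = sym (*-distribˡ-+ c (f 0) _)

∑-suc : ∀ n f → ∑ (suc n) f ≡ ∑ n f + f n
∑-suc zero    f = +-comm (f 0) 0
∑-suc (suc n) f rewrite ∑-suc n (f ∘ suc) = sym (+-assoc (f 0) _ _)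

∑-+ : ∀ m n f → ∑ (m + n) f ≡ ∑ m f + ∑ n (λ i → f (m + i))
∑-+ zero    n f = refl
∑-+ (suc m) n f rewrite ∑-+ m n (f ∘ suc) = sym (+-assoc (f 0) _ _)

∑-comm : ∀ m n (f : ℕ → ℕ → ℕ) → ∑ m (λ i → ∑ n (f i)) ≡ ∑ n (λ j → ∑ m (λ i → f i j))
∑-comm zero    n f = sym (∑-zero n)
∑-comm (suc m) n f rewrite ∑-comm m n (f ∘ suc) = sym (∑-distrib-+ n (f 0) _)

∑-reverse : ∀ n (f : ℕ → ℕ) → ∑ (suc n) (λ i → f (n ∸ i)) ≡ ∑ (suc n) f
∑-reverse zero    f = refl
∑-reverse (suc n) f = begin
  f (suc n) + ∑ (suc n) (λ i → f (n ∸ i)) ≡⟨ cong (_+_ (f (suc n))) (∑-reverse n f) ⟩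
  f (suc n) + ∑ (suc n) f                 ≡⟨ +-comm (f (suc n)) _ ⟩
  ∑ (suc n) f + f (suc n)                 ≡⟨ ∑-suc (suc n) f ⟨
  ∑ (suc (suc n)) f                       ∎
  where open ≡-Reasoning

∑-reverse′ : ∀ n (f : ℕ → ℕ) → ∑ n (λ i → f (n ∸ i)) ≡ ∑ n (f ∘ suc)
∑-reverse′ zero    f = refl
∑-reverse′ (suc n) f =
  trans (∑-cong (suc n) (λ i i≤n → cong f (+-∸-assoc 1 (≤-pred i≤n)))) (∑-reverse n (f ∘ suc))

∑-select : ∀ n k (f : ℕ → ℕ) → k < n → ∑ n (λ i → 𝟙 (k ≡ᵇ i) * f i) ≡ f k
∑-select (suc n) zero    f _         = trans (cong (_+_ (f 0 + 0)) (∑-zero n)) (trans (+-identityʳ _) (+-identityʳ _))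
∑-select (suc n) (suc k) f (s≤s k<n) = ∑-select n k (f ∘ suc) k<n

∑-triangle : ℕ → (ℕ → ℕ → ℕ) → ℕ
∑-triangle N H = ∑ N (λ q → ∑ (N ∸ q) (H q))

∑-triangle-suc : ∀ N H → ∑-triangle (suc N) H ≡ ∑-triangle N H + ∑ (suc N) (λ q → H q (N ∸ q))
∑-triangle-suc N H = begin
  ∑ (suc N) (λ q → ∑ (suc N ∸ q) (H q))
    ≡⟨ ∑-cong (suc N) (λ q q≤N → trans (cong (λ k → ∑ k (H q)) (+-∸-assoc 1 (≤-pred q≤N))) (∑-suc (N ∸ q) (H q))) ⟩
  ∑ (suc N) (λ q → ∑ (N ∸ q) (H q) + H q (N ∸ q))
    ≡⟨ ∑-distrib-+ (suc N) (λ q → ∑ (N ∸ q) (H q)) (λ q → H q (N ∸ q)) ⟩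
  ∑ (suc N) (λ q → ∑ (N ∸ q) (H q)) + ∑ (suc N) (λ q → H q (N ∸ q))
    ≡⟨ cong (_+ ∑ (suc N) (λ q → H q (N ∸ q))) (begin
         ∑ (suc N) (λ q → ∑ (N ∸ q) (H q))         ≡⟨ ∑-suc N (λ q → ∑ (N ∸ q) (H q)) ⟩
         ∑-triangle N H + ∑ (N ∸ N) (H N)          ≡⟨ cong (λ k → ∑-triangle N H + ∑ k (H N)) (n∸n≡0 N) ⟩
         ∑-triangle N H + 0                        ≡⟨ +-identityʳ _ ⟩
         ∑-triangle N H                            ∎) ⟩
  ∑-triangle N H + ∑ (suc N) (λ q → H q (N ∸ q))
    ∎
  where open ≡-Reasoning

∑-triangle-comm : ∀ N H → ∑-triangle N H ≡ ∑-triangle N (λ i q → H q i)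
∑-triangle-comm zero    H = refl
∑-triangle-comm (suc N) H = begin
  ∑-triangle (suc N) H                                              ≡⟨ ∑-triangle-suc N H ⟩
  ∑-triangle N H + ∑ (suc N) (λ q → H q (N ∸ q))                    ≡⟨ cong₂ _+_ (∑-triangle-comm N H) antidiagonal ⟩
  ∑-triangle N (λ i q → H q i) + ∑ (suc N) (λ i → H (N ∸ i) i)     ≡⟨ ∑-triangle-suc N (λ i q → H q i) ⟨
  ∑-triangle (suc N) (λ i q → H q i)                                ∎
  where
  open ≡-Reasoning
  antidiagonal : ∑ (suc N) (λ q → H q (N ∸ q)) ≡ ∑ (suc N) (λ i → H (N ∸ i) i)
  antidiagonal = sym (trans (∑-cong (suc N) (λ i i≤N → cong (H (N ∸ i)) (sym (m∸[m∸n]≡n (≤-pred i≤N)))))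
                            (∑-reverse N (λ q → H q (N ∸ q))))

-- ℓ occurs in the inner sums for q ≥ ℓ ∸ 1, that is K ∸ ℓ + 1 times if ℓ ≥ 1 and K times if ℓ = 0.
∑-prefix-sums : ∀ K (g : ℕ → ℕ) →
  ∑ K (λ q → ∑ (suc (suc q)) g) ≡ ∑ (suc K) (λ ℓ → (suc K ∸ ℓ ∸ δ ℓ 0) * g ℓ)
∑-prefix-sums zero    g = refl
∑-prefix-sums (suc K) g = begin
  ∑ (suc K) (λ q → ∑ (suc (suc q)) g)
    ≡⟨ ∑-suc K (λ q → ∑ (suc (suc q)) g) ⟩
  ∑ K (λ q → ∑ (suc (suc q)) g) + ∑ (suc (suc K)) g
    ≡⟨ cong₂ _+_ (∑-prefix-sums K g) (∑-suc (suc K) g) ⟩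
  ∑ (suc K) (weighted K) + (∑ (suc K) g + g (suc K))
    ≡⟨ +-assoc-swap (∑ (suc K) (weighted K)) (∑ (suc K) g) (g (suc K)) ⟩
  (∑ (suc K) g + ∑ (suc K) (weighted K)) + 1 * g (suc K)
    ≡⟨ cong₂ _+_ (trans (sym (∑-distrib-+ (suc K) g (weighted K))) (∑-cong (suc K) (λ ℓ ℓ≤K → sym (weight-suc ℓ ℓ≤K))))
                 (cong (_* g (suc K)) (sym (m+n∸n≡m 1 K))) ⟩
  ∑ (suc K) (weighted (suc K)) + weighted (suc K) (suc K)
    ≡⟨ ∑-suc (suc K) (weighted (suc K)) ⟨
  ∑ (suc (suc K)) (weighted (suc K))
    ∎
  where
  open ≡-Reasoning
  weighted : ℕ → ℕ → ℕ
  weighted K ℓ = (suc K ∸ ℓ ∸ δ ℓ 0) * g ℓ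
  +-assoc-swap : ∀ r a b → r + (a + b) ≡ (a + r) + 1 * b
  +-assoc-swap = solve-∀
  weight-suc : ∀ ℓ → ℓ < suc K → weighted (suc K) ℓ ≡ g ℓ + weighted K ℓ
  weight-suc zero    _         = refl
  weight-suc (suc l) (s≤s l<K) = cong (_* g (suc l)) (+-∸-assoc 1 (≤-trans (n≤1+n l) l<K))

∑-reindex : ∀ n s (b g : ℕ → ℕ → ℕ) →
  ∑ n (λ q → ∑ (n ∸ suc q) (λ i → ∑ s (λ m → b i m * ∑ (suc (suc q)) (g m)))) ≡
  ∑ (n ∸ 1) (λ i → ∑ s (λ m → b i m * ∑ (suc (n ∸ i ∸ 1)) (λ ℓ → (n ∸ i ∸ ℓ ∸ δ ℓ 0) * g m ℓ)))
∑-reindex zero    s b g = refl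
∑-reindex (suc N) s b g = begin
  ∑ (suc N) (λ q → ∑ (N ∸ q) (H q))
    ≡⟨ ∑-suc N (λ q → ∑ (N ∸ q) (H q)) ⟩
  ∑-triangle N H + ∑ (N ∸ N) (H N)
    ≡⟨ trans (cong (λ k → ∑-triangle N H + ∑ k (H N)) (n∸n≡0 N)) (+-identityʳ _) ⟩
  ∑-triangle N H
    ≡⟨ ∑-triangle-comm N H ⟩
  ∑ N (λ i → ∑ (N ∸ i) (λ q → H q i))
    ≡⟨ ∑-cong N (λ i i<N → begin
         ∑ (N ∸ i) (λ q → ∑ s (λ m → b i m * ∑ (suc (suc q)) (g m)))
           ≡⟨ ∑-comm (N ∸ i) s _ ⟩
         ∑ s (λ m → ∑ (N ∸ i) (λ q → b i m * ∑ (suc (suc q)) (g m)))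
           ≡⟨ ∑-cong s (λ m _ → trans (∑-*ˡ (N ∸ i) (b i m) _) (cong (_*_ (b i m)) (∑-prefix-sums (N ∸ i) (g m)))) ⟩
         ∑ s (λ m → b i m * ∑ (suc (N ∸ i)) (λ ℓ → (suc (N ∸ i) ∸ ℓ ∸ δ ℓ 0) * g m ℓ))
           ≡⟨ cong (λ k → ∑ s (λ m → b i m * ∑ (suc (k ∸ 1)) (λ ℓ → (k ∸ ℓ ∸ δ ℓ 0) * g m ℓ)))
                   (sym (+-∸-assoc 1 (<⇒≤ i<N))) ⟩
         ∑ s (λ m → b i m * ∑ (suc (suc N ∸ i ∸ 1)) (λ ℓ → (suc N ∸ i ∸ ℓ ∸ δ ℓ 0) * g m ℓ))
           ∎) ⟩
  ∑ N (λ i → ∑ s (λ m → b i m * ∑ (suc (suc N ∸ i ∸ 1)) (λ ℓ → (suc N ∸ i ∸ ℓ ∸ δ ℓ 0) * g m ℓ)))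
    ∎
  where
  open ≡-Reasoning
  H : ℕ → ℕ → ℕ
  H q i = ∑ s (λ m → b i m * ∑ (suc (suc q)) (g m))

sumMap : ∀ {A : Set} → (A → ℕ) → List A → ℕ
sumMap f xs = sum (map f xs)

sumMap-++ : ∀ {A : Set} (f : A → ℕ) xs ys → sumMap f (xs ++ ys) ≡ sumMap f xs + sumMap f ys
sumMap-++ f xs ys = trans (cong sum (map-++ f xs ys)) (sum-++ (map f xs) (map f ys))

sumMap-concatMap : ∀ {A B : Set} (f : B → ℕ) (g : A → List B) xs →
                   sumMap f (concatMap g xs) ≡ sumMap (sumMap f ∘ g) xs
sumMap-concatMap f g []       = refl
sumMap-concatMap f g (x ∷ xs) =
  trans (sumMap-++ f (g x) (concatMap g xs)) (cong (_+_ (sumMap f (g x))) (sumMap-concatMap f g xs))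

sumMap-map : ∀ {A B : Set} (f : B → ℕ) (g : A → B) xs → sumMap f (map g xs) ≡ sumMap (f ∘ g) xs
sumMap-map f g []       = refl
sumMap-map f g (x ∷ xs) = cong (_+_ (f (g x))) (sumMap-map f g xs)

sumMap-cong : ∀ {A : Set} {f g : A → ℕ} xs → (∀ x → f x ≡ g x) → sumMap f xs ≡ sumMap g xs
sumMap-cong []       f≗g = refl
sumMap-cong (x ∷ xs) f≗g = cong₂ _+_ (f≗g x) (sumMap-cong xs f≗g)

sumMap-applyUpTo : ∀ (f h : ℕ → ℕ) n → sumMap f (applyUpTo h n) ≡ ∑ n (f ∘ h)
sumMap-applyUpTo f h zero    = refl
sumMap-applyUpTo f h (suc n) = cong (_+_ (f (h 0))) (sumMap-applyUpTo f (h ∘ suc) n)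

length-filterᵇ : ∀ {A : Set} (p : A → Bool) xs → length (filterᵇ p xs) ≡ sumMap (𝟙 ∘ p) xs
length-filterᵇ p []       = refl
length-filterᵇ p (x ∷ xs) with p x
... | true  = cong suc (length-filterᵇ p xs)
... | false = length-filterᵇ p xs

sumFT-∑ : ∀ a b f → sumFT a b f ≡ ∑ (suc b ∸ a) (λ i → f (a + i))
sumFT-∑ a b f = sumMap-applyUpTo f (_+_ a) (suc b ∸ a)

-- Sums over staircases

-- ∑ˢ n u d f sums f over the lists x₀ ⋯ x_{n-1} with x_i < u + i·d: for d = 1 these are
-- shifted inversion sequences, for d = 0 the words of length n over an alphabet of size u.
∑ˢ : ℕ → ℕ → ℕ → (List ℕ → ℕ) → ℕ
∑ˢ zero    u d f = f []
∑ˢ (suc n) u d f = ∑ u (λ x → ∑ˢ n (d + u) d (λ τ → f (x ∷ τ)))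

Staircase : ℕ → ℕ → List ℕ → Set
Staircase u d []      = ⊤
Staircase u d (x ∷ τ) = x < u × Staircase (d + u) d τ

Staircase⇒All : ∀ k σ → Staircase k 0 σ → All (_< k) σ
Staircase⇒All k []      _           = []
Staircase⇒All k (x ∷ σ) (x<k , σ↓) = x<k ∷ Staircase⇒All k σ σ↓

∑ˢ-cong : ∀ n u d {f g : List ℕ → ℕ} →
          (∀ σ → Staircase u d σ → length σ ≡ n → f σ ≡ g σ) → ∑ˢ n u d f ≡ ∑ˢ n u d g
∑ˢ-cong zero    u d f≗g = f≗g [] tt refl
∑ˢ-cong (suc n) u d f≗g =
  ∑-cong u (λ x x<u → ∑ˢ-cong n (d + u) d (λ τ τ↓ |τ| → f≗g (x ∷ τ) (x<u , τ↓) (cong suc |τ|)))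

∑ˢ-zero : ∀ n u d → ∑ˢ n u d (λ _ → 0) ≡ 0
∑ˢ-zero zero    u d = refl
∑ˢ-zero (suc n) u d = trans (∑-cong u (λ _ _ → ∑ˢ-zero n (d + u) d)) (∑-zero u)

∑ˢ-distrib-+ : ∀ n u d (f g : List ℕ → ℕ) → ∑ˢ n u d (λ σ → f σ + g σ) ≡ ∑ˢ n u d f + ∑ˢ n u d g
∑ˢ-distrib-+ zero    u d f g = refl
∑ˢ-distrib-+ (suc n) u d f g =
  trans (∑-cong u (λ x _ → ∑ˢ-distrib-+ n (d + u) d (f ∘ (x ∷_)) (g ∘ (x ∷_)))) (∑-distrib-+ u _ _)

∑ˢ-*ˡ : ∀ n u d c (f : List ℕ → ℕ) → ∑ˢ n u d (λ σ → c * f σ) ≡ c * ∑ˢ n u d f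
∑ˢ-*ˡ zero    u d c f = refl
∑ˢ-*ˡ (suc n) u d c f =
  trans (∑-cong u (λ x _ → ∑ˢ-*ˡ n (d + u) d c (f ∘ (x ∷_)))) (∑-*ˡ u c _)

∑ˢ-∑ : ∀ n u d k (f : ℕ → List ℕ → ℕ) → ∑ˢ n u d (λ σ → ∑ k (λ i → f i σ)) ≡ ∑ k (λ i → ∑ˢ n u d (f i))
∑ˢ-∑ zero    u d k f = refl
∑ˢ-∑ (suc n) u d k f =
  trans (∑-cong u (λ x _ → ∑ˢ-∑ n (d + u) d k (λ i τ → f i (x ∷ τ)))) (∑-comm u k _)

∑ˢ-snoc : ∀ n u d f → ∑ˢ (suc n) u d f ≡ ∑ˢ n u d (λ σ → ∑ (n * d + u) (λ v → f (σ ++ [ v ])))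
∑ˢ-snoc zero    u d f = refl
∑ˢ-snoc (suc n) u d f = ∑-cong u λ x _ →
  trans (∑ˢ-snoc n (d + u) d (f ∘ (x ∷_)))
        (cong (λ k → ∑ˢ n (d + u) d (λ σ → ∑ k (λ v → f (x ∷ σ ++ [ v ])))) (bound n d u))
  where
  bound : ∀ n d u → n * d + (d + u) ≡ suc n * d + u
  bound = solve-∀

∑ˢ-shift : ∀ n c u d (f : List ℕ → ℕ) →
           ∑ˢ n (c + u) d (λ σ → 𝟙 (all (c ≤ᵇ_) σ) * f σ) ≡ ∑ˢ n u d (f ∘ map (_+_ c))
∑ˢ-shift zero    c u d f = +-identityʳ (f [])
∑ˢ-shift (suc n) c u d f = begin
  ∑ (c + u) (λ x → ∑ˢ n (d + (c + u)) d (g x))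
    ≡⟨ ∑-+ c u _ ⟩
  ∑ c (λ x → ∑ˢ n (d + (c + u)) d (g x)) + ∑ u (λ i → ∑ˢ n (d + (c + u)) d (g (c + i)))
    ≡⟨ cong₂ _+_ (trans (∑-cong c below) (∑-zero c)) (∑-cong u above) ⟩
  0 + ∑ˢ (suc n) u d (f ∘ map (_+_ c))
    ∎
  where
  open ≡-Reasoning
  g : ℕ → List ℕ → ℕ
  g x τ = 𝟙 ((c ≤ᵇ x) ∧ all (c ≤ᵇ_) τ) * f (x ∷ τ)
  below : ∀ x → x < c → ∑ˢ n (d + (c + u)) d (g x) ≡ 0
  below x x<c = trans (∑ˢ-cong n _ d (λ τ _ _ → cong (λ b → 𝟙 (b ∧ all (c ≤ᵇ_) τ) * f (x ∷ τ))
                                         (det (≤ᵇ-reflects-≤ c x) (ofⁿ (<⇒≱ x<c)))))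
                      (∑ˢ-zero n _ d)
  above : ∀ i → i < u → ∑ˢ n (d + (c + u)) d (g (c + i)) ≡ ∑ˢ n (d + u) d (λ τ → f (map (_+_ c) (i ∷ τ)))
  above i _ = begin
    ∑ˢ n (d + (c + u)) d (g (c + i))
      ≡⟨ ∑ˢ-cong n _ d (λ τ _ _ → cong (λ b → 𝟙 (b ∧ all (c ≤ᵇ_) τ) * f (c + i ∷ τ))
                                        (det (≤ᵇ-reflects-≤ c (c + i)) (ofʸ (m≤m+n c i)))) ⟩
    ∑ˢ n (d + (c + u)) d (λ τ → 𝟙 (all (c ≤ᵇ_) τ) * f (c + i ∷ τ))
      ≡⟨ cong (λ k → ∑ˢ n k d (λ τ → 𝟙 (all (c ≤ᵇ_) τ) * f (c + i ∷ τ))) (x∙yz≈y∙xz d c u) ⟩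
    ∑ˢ n (c + (d + u)) d (λ τ → 𝟙 (all (c ≤ᵇ_) τ) * f (c + i ∷ τ))
      ≡⟨ ∑ˢ-shift n c (d + u) d (f ∘ (c + i ∷_)) ⟩
    ∑ˢ n (d + u) d (λ τ → f (map (_+_ c) (i ∷ τ)))
      ∎

∑ˢ-restrict : ∀ n j e d (f : List ℕ → ℕ) → ∑ˢ n (j + e) d (λ σ → 𝟙 (all (_<ᵇ j) σ) * f σ) ≡ ∑ˢ n j 0 f
∑ˢ-restrict zero    j e d f = +-identityʳ (f [])
∑ˢ-restrict (suc n) j e d f = begin
  ∑ (j + e) (λ x → ∑ˢ n (d + (j + e)) d (g x))
    ≡⟨ ∑-+ j e _ ⟩
  ∑ j (λ x → ∑ˢ n (d + (j + e)) d (g x)) + ∑ e (λ i → ∑ˢ n (d + (j + e)) d (g (j + i)))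
    ≡⟨ cong₂ _+_ (∑-cong j inside) (trans (∑-cong e outside) (∑-zero e)) ⟩
  ∑ˢ (suc n) j 0 f + 0
    ≡⟨ +-identityʳ _ ⟩
  ∑ˢ (suc n) j 0 f
    ∎
  where
  open ≡-Reasoning
  g : ℕ → List ℕ → ℕ
  g x τ = 𝟙 ((x <ᵇ j) ∧ all (_<ᵇ j) τ) * f (x ∷ τ)
  inside : ∀ x → x < j → ∑ˢ n (d + (j + e)) d (g x) ≡ ∑ˢ n j 0 (f ∘ (x ∷_))
  inside x x<j = begin
    ∑ˢ n (d + (j + e)) d (g x)
      ≡⟨ ∑ˢ-cong n _ d (λ τ _ _ → cong (λ b → 𝟙 (b ∧ all (_<ᵇ j) τ) * f (x ∷ τ))
                                        (det (<ᵇ-reflects-< x j) (ofʸ x<j))) ⟩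
    ∑ˢ n (d + (j + e)) d (λ τ → 𝟙 (all (_<ᵇ j) τ) * f (x ∷ τ))
      ≡⟨ cong (λ k → ∑ˢ n k d (λ τ → 𝟙 (all (_<ᵇ j) τ) * f (x ∷ τ))) (x∙yz≈y∙xz d j e) ⟩
    ∑ˢ n (j + (d + e)) d (λ τ → 𝟙 (all (_<ᵇ j) τ) * f (x ∷ τ))
      ≡⟨ ∑ˢ-restrict n j (d + e) d (f ∘ (x ∷_)) ⟩
    ∑ˢ n j 0 (f ∘ (x ∷_))
      ∎
  outside : ∀ i → i < e → ∑ˢ n (d + (j + e)) d (g (j + i)) ≡ 0
  outside i _ = trans (∑ˢ-cong n _ d (λ τ _ _ → cong (λ b → 𝟙 (b ∧ all (_<ᵇ j) τ) * f (j + i ∷ τ))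
                                         (det (<ᵇ-reflects-< (j + i) j) (ofⁿ (m+n≮m j i)))))
                      (∑ˢ-zero n _ d)

sumMap-shiftedSeqs : ∀ n u (f : List ℕ → ℕ) → sumMap f (shiftedSeqs n ((+ u) ℤ.- (+ 1))) ≡ ∑ˢ n u 1 f
sumMap-shiftedSeqs zero    u f = +-identityʳ (f [])
sumMap-shiftedSeqs (suc n) u f = begin
  sumMap f (shiftedSeqs (suc n) s)
    ≡⟨ sumMap-concatMap f _ (shiftedSeqs n s) ⟩
  sumMap (λ σ → sumMap f (map (λ v → σ ++ [ v ]) (upTo (nVals (suc n) s)))) (shiftedSeqs n s)
    ≡⟨ sumMap-cong (shiftedSeqs n s) (λ σ → trans (sumMap-map f _ (upTo (nVals (suc n) s)))
                                                         (sumMap-applyUpTo _ id (nVals (suc n) s))) ⟩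
  sumMap (λ σ → ∑ (nVals (suc n) s) (λ v → f (σ ++ [ v ]))) (shiftedSeqs n s)
    ≡⟨ sumMap-shiftedSeqs n u _ ⟩
  ∑ˢ n u 1 (λ σ → ∑ (nVals (suc n) s) (λ v → f (σ ++ [ v ])))
    ≡⟨ cong (λ k → ∑ˢ n u 1 (λ σ → ∑ k (λ v → f (σ ++ [ v ]))))
            (trans (nVals-pred u) (cong (_+ u) (sym (*-identityʳ n)))) ⟩
  ∑ˢ n u 1 (λ σ → ∑ (n * 1 + u) (λ v → f (σ ++ [ v ])))
    ≡⟨ ∑ˢ-snoc n u 1 f ⟨
  ∑ˢ (suc n) u 1 f
    ∎
  where
  open ≡-Reasoning
  s : ℤ
  s = (+ u) ℤ.- (+ 1)
  nVals-pred : ∀ u → nVals (suc n) ((+ u) ℤ.- (+ 1)) ≡ n + u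
  nVals-pred zero    = trans (⊔-identityʳ n) (sym (+-identityʳ n))
  nVals-pred (suc u) = begin
    ℤ.∣ (+ suc n) ℤ.+ ((+ suc u) ℤ.- (+ 1)) ℤ.⊔ 0ℤ ∣
      ≡⟨ cong (λ z → ℤ.∣ (+ suc n) ℤ.+ z ℤ.⊔ 0ℤ ∣) (ℤₚ.[+m]-[+n]≡m⊖n (suc u) 1) ⟩
    ℤ.∣ (+ suc n) ℤ.+ (+ u) ℤ.⊔ 0ℤ ∣
      ≡⟨ cong (λ z → ℤ.∣ z ℤ.⊔ 0ℤ ∣) (ℤₚ.pos-+ (suc n) u) ⟨
    suc n + u ⊔ 0
      ≡⟨ ⊔-identityʳ (suc n + u) ⟩
    suc n + u
      ≡⟨ +-suc n u ⟨
    n + suc u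
      ∎

sumMap-words : ∀ n k (f : List ℕ → ℕ) → sumMap f (words n k) ≡ ∑ˢ n k 0 f
sumMap-words zero    k f = +-identityʳ (f [])
sumMap-words (suc n) k f = begin
  sumMap f (words (suc n) k)
    ≡⟨ sumMap-concatMap f _ (words n k) ⟩
  sumMap (λ w → sumMap f (map (λ v → v ∷ w) (upTo k))) (words n k)
    ≡⟨ sumMap-cong (words n k) (λ w → trans (sumMap-map f _ (upTo k)) (sumMap-applyUpTo _ id k)) ⟩
  sumMap (λ w → ∑ k (λ v → f (v ∷ w))) (words n k)
    ≡⟨ sumMap-words n k _ ⟩
  ∑ˢ n k 0 (λ w → ∑ k (λ v → f (v ∷ w)))
    ≡⟨ ∑ˢ-∑ n k 0 k (λ v w → f (v ∷ w)) ⟩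
  ∑ˢ (suc n) k 0 f
    ∎
  where open ≡-Reasoning

-- 𝒜 n (s + 1) = 𝔞 n s, so that the shift s ≥ -1 becomes a natural number.
𝒜 : ℕ → ℕ → ℕ
𝒜 n u = ∑ˢ n u 1 (𝟙 ∘ avoidsBoth)

𝔞≡𝒜 : ∀ n u {s} → s ≡ (+ u) ℤ.- (+ 1) → 𝔞 n s ≡ 𝒜 n u
𝔞≡𝒜 n u refl = trans (length-filterᵇ avoidsBoth (shiftedSeqs n _)) (sumMap-shiftedSeqs n u _)

𝔟≡∑ˢ : ∀ r m → 𝔟 r m ≡ ∑ˢ r m 0 (λ w → 𝟙 (avoidsBoth w ∧ hasMax m w))
𝔟≡∑ˢ r m = trans (length-filterᵇ _ (words r m)) (sumMap-words r m _)

-- Pattern avoidance as a property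

map-reflects : ∀ {A B : Set} {b} → (A → B) → (B → A) → Reflects A b → Reflects B b
map-reflects f g (ofʸ a)  = ofʸ (f a)
map-reflects f g (ofⁿ ¬a) = ofⁿ (¬a ∘ g)

reflects⇒⇔ : ∀ {A : Set} {b} → Reflects A b → T b ⇔ A
reflects⇒⇔ (ofʸ a)  = mk⇔ (λ _ → a) (λ _ → tt)
reflects⇒⇔ (ofⁿ ¬a) = mk⇔ (λ ()) ¬a

reflects-≡ : ∀ {A B : Set} {a b} → Reflects A a → Reflects B b → (A → B) → (B → A) → a ≡ b
reflects-≡ ra rb f g = det (map-reflects f g ra) rb

≡ᵇ-reflects-≡ : ∀ m n → Reflects (m ≡ n) (m ≡ᵇ n)
≡ᵇ-reflects-≡ m n = fromEquivalence (≡ᵇ⇒≡ m n) (≡⇒≡ᵇ m n)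

any-reflects : ∀ {A : Set} {P : A → Set} {p : A → Bool} →
               (∀ x → Reflects (P x) (p x)) → ∀ xs → Reflects (Any P xs) (any p xs)
any-reflects P? []       = ofⁿ (λ ())
any-reflects P? (x ∷ xs) = map-reflects [ here , there ]′ (λ { (here px) → inj₁ px ; (there pxs) → inj₂ pxs })
                                        (P? x ⊎-reflects any-reflects P? xs)

all-reflects : ∀ {A : Set} {P : A → Set} {p : A → Bool} →
               (∀ x → Reflects (P x) (p x)) → ∀ xs → Reflects (All P xs) (all p xs)
all-reflects P? []       = ofʸ []
all-reflects P? (x ∷ xs) = map-reflects (λ (px , pxs) → px ∷ pxs) All.uncons (P? x ×-reflects all-reflects P? xs)

positive : List ℕ → Bool
positive = all (1 ≤ᵇ_)

positive-reflects : ∀ σ → Reflects (All (0 <_) σ) (positive σ)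
positive-reflects = all-reflects (≤ᵇ-reflects-≤ 1)

sameCmp-< : ∀ u v → Reflects (u < v) (sameCmp 0 1 u v)
sameCmp-< u v = map-reflects proj₁ (λ u<v → u<v , <⇒≢ u<v , <⇒≯ u<v)
  (<ᵇ-reflects-< u v ×-reflects ¬-reflects (≡ᵇ-reflects-≡ u v) ×-reflects ¬-reflects (<ᵇ-reflects-< v u))

sameCmp-≡ : ∀ u v → Reflects (u ≡ v) (sameCmp 0 0 u v)
sameCmp-≡ u v = map-reflects (proj₁ ∘ proj₂) (λ { refl → <-irrefl refl , refl , <-irrefl refl })
  (¬-reflects (<ᵇ-reflects-< u v) ×-reflects ≡ᵇ-reflects-≡ u v ×-reflects ¬-reflects (<ᵇ-reflects-< v u))

sameCmp-> : ∀ u v → Reflects (v < u) (sameCmp 1 0 u v)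
sameCmp-> u v = map-reflects (proj₂ ∘ proj₂) (λ v<u → <⇒≯ v<u , ≢-sym (<⇒≢ v<u) , v<u)
  (¬-reflects (<ᵇ-reflects-< u v) ×-reflects ¬-reflects (≡ᵇ-reflects-≡ u v) ×-reflects <ᵇ-reflects-< v u)

orderIso-triple : ∀ p q r x a b {P Q R : Set} →
  Reflects P (sameCmp p q x a) → Reflects Q (sameCmp p r x b) → Reflects R (sameCmp q r a b) →
  Reflects (P × Q × R) (orderIso (p ∷ q ∷ r ∷ []) (x ∷ a ∷ b ∷ []))
orderIso-triple p q r x a b P? Q? R? =
  map-reflects (λ ((p , q , _) , (r , _) , _) → p , q , r) (λ (p , q , r) → (p , q , tt) , (r , tt) , tt , tt)
    ((P? ×-reflects Q? ×-reflects ofʸ tt) ×-reflects (R? ×-reflects ofʸ tt) ×-reflects ofʸ tt ×-reflects ofʸ tt)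

Occ010 Occ102 : ℕ → ℕ → ℕ → Set
Occ010 x a b = x < a × b ≡ x
Occ102 x a b = a < x × x < b

occ010-reflects : ∀ x a b → Reflects (Occ010 x a b) (orderIso p010 (x ∷ a ∷ b ∷ []))
occ010-reflects x a b = map-reflects (λ (x<a , x≡b , _) → x<a , sym x≡b) (λ { (x<a , refl) → x<a , refl , x<a })
  (orderIso-triple 0 1 0 x a b (sameCmp-< x a) (sameCmp-≡ x b) (sameCmp-> a b))

occ102-reflects : ∀ x a b → Reflects (Occ102 x a b) (orderIso p102 (x ∷ a ∷ b ∷ []))
occ102-reflects x a b = map-reflects (λ (a<x , x<b , _) → a<x , x<b) (λ (a<x , x<b) → a<x , x<b , <-trans a<x x<b)
  (orderIso-triple 1 0 2 x a b (sameCmp-> x a) (sameCmp-< x b) (sameCmp-< a b))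

Harmless : ℕ → ℕ → ℕ → Set
Harmless x a b = ¬ Occ010 x a b × ¬ Occ102 x a b

Avoiding : List ℕ → Set
Avoiding []      = ⊤
Avoiding (x ∷ τ) = AllPairs (Harmless x) τ × Avoiding τ

subseqs-1 : ∀ xs → subseqs 1 xs ≡ map [_] xs
subseqs-1 []       = refl
subseqs-1 (x ∷ xs) = cong ([ x ] ∷_) (subseqs-1 xs)

All-subseqs-∷ : ∀ {P : List ℕ → Set} k x xs →
  All P (subseqs (suc k) (x ∷ xs)) ⇔ (All (P ∘ (x ∷_)) (subseqs k xs) × All P (subseqs (suc k) xs))
All-subseqs-∷ k x xs =
  mk⇔ (λ h → let (l , r) = ++⁻ _ h in All-map⁻ l , r) (λ (l , r) → ++⁺ (All-map⁺ l) r)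

All-subseqs-2 : ∀ {P : List ℕ → Set} xs → All P (subseqs 2 xs) ⇔ AllPairs (λ a b → P (a ∷ b ∷ [])) xs
All-subseqs-2         []       = mk⇔ (λ _ → []) (λ _ → [])
All-subseqs-2 {P = P} (a ∷ xs) = mk⇔
  (λ h → let (l , r) = to (All-subseqs-∷ 1 a xs) h in
         All-map⁻ (subst (All (P ∘ (a ∷_))) (subseqs-1 xs) l) ∷ to (All-subseqs-2 xs) r)
  (λ { (l ∷ r) → from (All-subseqs-∷ 1 a xs)
                   (subst (All (P ∘ (a ∷_))) (sym (subseqs-1 xs)) (All-map⁺ l) , from (All-subseqs-2 xs) r) })

Clean : List ℕ → Set
Clean t = ¬ T (orderIso p010 t) × ¬ T (orderIso p102 t)

Clean⇔Harmless : ∀ x a b → Clean (x ∷ a ∷ b ∷ []) ⇔ Harmless x a b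
Clean⇔Harmless x a b = mk⇔
  (λ (c₁ , c₂) → c₁ ∘ from (reflects⇒⇔ (occ010-reflects x a b)) , c₂ ∘ from (reflects⇒⇔ (occ102-reflects x a b)))
  (λ (h₁ , h₂) → h₁ ∘ to (reflects⇒⇔ (occ010-reflects x a b)) , h₂ ∘ to (reflects⇒⇔ (occ102-reflects x a b)))

All-Clean⇔Avoiding : ∀ σ → All Clean (subseqs 3 σ) ⇔ Avoiding σ
All-Clean⇔Avoiding []      = mk⇔ (λ _ → tt) (λ _ → [])
All-Clean⇔Avoiding (x ∷ τ) = mk⇔
  (λ h → let (l , r) = to (All-subseqs-∷ 2 x τ) h in
         AllPairs.map (to (Clean⇔Harmless x _ _)) (to (All-subseqs-2 τ) l) , to (All-Clean⇔Avoiding τ) r)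
  (λ (l , r) → from (All-subseqs-∷ 2 x τ)
                 (from (All-subseqs-2 τ) (AllPairs.map (from (Clean⇔Harmless x _ _)) l) , from (All-Clean⇔Avoiding τ) r))

avoidsBoth-reflects : ∀ σ → Reflects (Avoiding σ) (avoidsBoth σ)
avoidsBoth-reflects σ = map-reflects
  (λ (¬010 , ¬102) → to (All-Clean⇔Avoiding σ) (All.zip (¬Any⇒All¬ _ ¬010 , ¬Any⇒All¬ _ ¬102)))
  (λ av → let (¬010 , ¬102) = All.unzip (from (All-Clean⇔Avoiding σ) av) in All¬⇒¬Any ¬010 , All¬⇒¬Any ¬102)
  (¬-reflects (any-reflects (T-reflects ∘ orderIso p010) (subseqs 3 σ))
   ×-reflects ¬-reflects (any-reflects (T-reflects ∘ orderIso p102) (subseqs 3 σ)))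

-- Cutting an avoider at a zero

AllPairs-++⁻ : ∀ {R : ℕ → ℕ → Set} xs {ys} → AllPairs R (xs ++ ys) →
               AllPairs R xs × AllPairs R ys × All (λ x → All (R x) ys) xs
AllPairs-++⁻ []       rs        = [] , rs , []
AllPairs-++⁻ (x ∷ xs) (r ∷ rs) =
  let (r₁ , r₂) = ++⁻ xs r ; (rs₁ , rs₂ , rs₃) = AllPairs-++⁻ xs rs in r₁ ∷ rs₁ , rs₂ , r₂ ∷ rs₃

AllPairs-zipˡ : ∀ {P : ℕ → Set} {R : ℕ → ℕ → Set} {xs} →
                All P xs → AllPairs R xs → AllPairs (λ x a → P x × R x a) xs
AllPairs-zipˡ []       []       = []
AllPairs-zipˡ (p ∷ ps) (r ∷ rs) = All.map (p ,_) r ∷ AllPairs-zipˡ ps rs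

All⇒AllPairs : ∀ {P : ℕ → Set} {R : ℕ → ℕ → Set} {xs} →
               (∀ {a b} → P a → P b → R a b) → All P xs → AllPairs R xs
All⇒AllPairs f []       = []
All⇒AllPairs f (p ∷ ps) = All.map (f p) ps ∷ All⇒AllPairs f ps

-- the triples of xs ++ ys with letters in both xs and ys
Across : List ℕ → List ℕ → Set
Across xs ys = AllPairs (λ x a → All (Harmless x a) ys) xs × All (λ x → AllPairs (Harmless x) ys) xs

Avoiding-++ : ∀ xs ys → Avoiding (xs ++ ys) ⇔ (Avoiding xs × Avoiding ys × Across xs ys)
Avoiding-++ []       ys = mk⇔ (λ av → tt , av , [] , []) (λ (_ , av , _) → av)
Avoiding-++ (x ∷ xs) ys = mk⇔
  (λ (h , av) → let (h₁ , h₂ , h₃) = AllPairs-++⁻ xs h ; (av₁ , av₂ , a₁ , a₂) = to (Avoiding-++ xs ys) av in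
                (h₁ , av₁) , av₂ , (h₃ ∷ a₁) , (h₂ ∷ a₂))
  (λ { ((h₁ , av₁) , av₂ , (h₃ ∷ a₁) , (h₂ ∷ a₂)) →
     AllPairs-++⁺ h₁ h₂ h₃ , from (Avoiding-++ xs ys) (av₁ , av₂ , a₁ , a₂) })

Harmless-+ : ∀ c x a b → Harmless (c + x) (c + a) (c + b) ⇔ Harmless x a b
Harmless-+ c x a b = mk⇔
  (λ (h₁ , h₂) → (λ (x<a , b≡x) → h₁ (+-monoʳ-< c x<a , cong (_+_ c) b≡x))
               , (λ (a<x , x<b) → h₂ (+-monoʳ-< c a<x , +-monoʳ-< c x<b)))
  (λ (h₁ , h₂) → (λ (x<a , b≡x) → h₁ (+-cancelˡ-< c x a x<a , +-cancelˡ-≡ c b x b≡x))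
               , (λ (a<x , x<b) → h₂ (+-cancelˡ-< c a x a<x , +-cancelˡ-< c x b x<b)))

Avoiding-+ : ∀ c σ → Avoiding (map (_+_ c) σ) ⇔ Avoiding σ
Avoiding-+ c []      = mk⇔ (λ _ → tt) (λ _ → tt)
Avoiding-+ c (x ∷ σ) = mk⇔
  (λ (h , av) → AllPairs.map (to (Harmless-+ c x _ _)) (AllPairs-map⁻ h) , to (Avoiding-+ c σ) av)
  (λ (h , av) → AllPairs-map⁺ (AllPairs.map (from (Harmless-+ c x _ _)) h) , from (Avoiding-+ c σ) av)

Harmless-≤ : ∀ {x a b} → a ≤ x → b ≤ x → Harmless x a b
Harmless-≤ a≤x b≤x = (λ (x<a , _) → <⇒≱ x<a a≤x) , (λ (_ , x<b) → <⇒≱ x<b b≤x)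

Beneath : List ℕ → List ℕ → Set
Beneath α γ = All (λ a → All (_≤ a) γ) α × AllPairs (λ a a' → All (¬_ ∘ Occ010 a a') γ) α

-- A 102 whose middle letter is the cut zero would need some c in γ above some x in α; once γ lies
-- below α, only the 010s x a c with x, a in α remain.
Avoiding-++-0∷ : ∀ α γ → All (0 <_) α →
                 Avoiding (α ++ 0 ∷ γ) ⇔ (Avoiding α × Avoiding (0 ∷ γ) × Beneath α γ)
Avoiding-++-0∷ α γ pos = mk⇔
  (λ av → let (avα , av0γ , cross₂ , cross₁) = to (Avoiding-++ α (0 ∷ γ)) av in
     avα , av0γ ,
     All.zipWith (λ { (0<x , (h ∷ _)) → All.map (λ (_ , no102) → ≮⇒≥ (λ x<c → no102 (0<x , x<c))) h }) (pos , cross₁) ,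
     AllPairs.map (λ { (_ ∷ h) → All.map proj₁ h }) cross₂)
  (λ (avα , av0γ , below , no010) → from (Avoiding-++ α (0 ∷ γ)) (avα , av0γ ,
     AllPairs.map (λ ((0<x , c≤x) , no010) →
                     ((λ (_ , 0≡x) → <⇒≢ 0<x 0≡x) , (λ ()))
                     ∷ All.zipWith (λ (c≤x , no010) → no010 , (λ (_ , x<c) → <⇒≱ x<c c≤x)) (c≤x , no010))
                  (AllPairs-zipˡ (All.zip (pos , below)) no010) ,
     All.zipWith (λ (0<x , c≤x) → All.map (λ c≤x → (λ ()) , (λ (_ , x<c) → <⇒≱ x<c c≤x)) c≤x
                                  ∷ All⇒AllPairs Harmless-≤ c≤x)
                 (pos , below)))

Avoiding-0∷0∷ : ∀ γ → Avoiding (0 ∷ 0 ∷ γ) ⇔ Avoiding (0 ∷ γ)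
Avoiding-0∷0∷ γ = mk⇔ proj₂ (λ av → (All.universal (λ _ → (λ ()) , (λ ())) γ ∷ proj₁ av) , av)

Avoiding-0∷ : ∀ β → All (0 <_) β → Avoiding (0 ∷ β) ⇔ Avoiding β
Avoiding-0∷ β pos = mk⇔ proj₂ (λ av → All⇒AllPairs (λ _ 0<b → (λ (_ , b≡0) → <⇒≢ 0<b (sym b≡0)) , (λ ())) pos , av)

Avoiding-0∷suc⇒positive : ∀ x γ → Avoiding (0 ∷ suc x ∷ γ) → All (0 <_) γ
Avoiding-0∷suc⇒positive x γ ((h ∷ _) , _) = All.map (λ (no010 , _) → n≢0⇒n>0 (λ c≡0 → no010 (z<s , c≡0))) h

Beneath-0∷ : ∀ α γ → All (0 <_) α → Beneath α (0 ∷ γ) ⇔ Beneath α γ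
Beneath-0∷ α γ pos = mk⇔
  (λ (below , no010) → All.map All.tail below , AllPairs.map All.tail no010)
  (λ (below , no010) → All.map (z≤n ∷_) below ,
     AllPairs.map (λ (0<a , h) → (λ (_ , 0≡a) → <⇒≢ 0<a 0≡a) ∷ h) (AllPairs-zipˡ pos no010))

Avoiding-++-0∷0∷ : ∀ α γ → All (0 <_) α → Avoiding (α ++ 0 ∷ 0 ∷ γ) ⇔ Avoiding (α ++ 0 ∷ γ)
Avoiding-++-0∷0∷ α γ pos = mk⇔
  (λ av → let (avα , av00γ , b) = to (Avoiding-++-0∷ α (0 ∷ γ) pos) av in
          from (Avoiding-++-0∷ α γ pos) (avα , to (Avoiding-0∷0∷ γ) av00γ , to (Beneath-0∷ α γ pos) b))
  (λ av → let (avα , av0γ , b) = to (Avoiding-++-0∷ α γ pos) av in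
          from (Avoiding-++-0∷ α (0 ∷ γ) pos) (avα , from (Avoiding-0∷0∷ γ) av0γ , from (Beneath-0∷ α γ pos) b))

Avoiding-++-[0] : ∀ α → All (0 <_) α → Avoiding (α ++ [ 0 ]) ⇔ Avoiding α
Avoiding-++-[0] α pos = mk⇔
  (λ av → proj₁ (to (Avoiding-++-0∷ α [] pos) av))
  (λ av → from (Avoiding-++-0∷ α [] pos) (av , ([] , tt) , All.map (λ _ → []) pos , All⇒AllPairs (λ _ _ → []) pos))

Avoiding-++-0∷⇒≤head : ∀ x α γ → All (0 <_) (x ∷ α) → Avoiding ((x ∷ α) ++ 0 ∷ γ) → All (_≤ x) γ
Avoiding-++-0∷⇒≤head x α γ pos av = All.head (proj₁ (proj₂ (proj₂ (to (Avoiding-++-0∷ (x ∷ α) γ pos) av))))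

-- α ∈ (m+1, m+2, …)* m*
Plateau : ℕ → List ℕ → Set
Plateau m α = All (m ≤_) α × AllPairs (λ a a' → ¬ Occ010 a a' m) α

above⇒Plateau : ∀ m α → All (suc m ≤_) α → Plateau m α
above⇒Plateau m α above = All.map <⇒≤ above , All⇒AllPairs (λ m<a _ (_ , m≡a) → <⇒≢ m<a m≡a) above

Plateau⇒positive : ∀ m α → Plateau (suc m) α → All (0 <_) α
Plateau⇒positive m α (m<α , _) = All.map (≤-trans (s≤s z≤n)) m<α

plateau? : ∀ m α → Dec (Plateau m α)
plateau? m α = All.all? (m ≤?_) α ×-dec AllPairs.allPairs? (λ a a' → ¬? ((a <? a') ×-dec (m ≟ a))) α

plateau : ℕ → List ℕ → Bool
plateau m α = does (plateau? m α)

Plateau-∷ʳ : ∀ m α v → Plateau m (α ++ [ v ]) ⇔ (Plateau m α × m ≤ v × All (λ a → ¬ Occ010 a v m) α)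
Plateau-∷ʳ m α v = mk⇔
  (λ (m≤ , no010) → let (m≤α , m≤v) = ++⁻ α m≤ ; (no010α , _ , no010v) = AllPairs-++⁻ α no010 in
                    (m≤α , no010α) , All.head m≤v , All.map All.head no010v)
  (λ ((m≤α , no010α) , m≤v , no010v) → ++⁺ m≤α (m≤v ∷ []) ,
                                        AllPairs-++⁺ no010α ([] ∷ []) (All.map (_∷ []) no010v))

Avoiding-∷ʳ : ∀ m α → Plateau m α → Avoiding α → Avoiding (α ++ [ m ])
Avoiding-∷ʳ m α (m≤ , no010) av = from (Avoiding-++ α [ m ]) (av , ([] , tt) ,
  AllPairs.map (λ (m≤x , no010) → (no010 , (λ (_ , x<m) → <⇒≱ x<m m≤x)) ∷ [])
               (AllPairs-zipˡ m≤ no010) ,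
  All.map (λ _ → [] ∷ []) m≤)

max∈ : ∀ b bs → max 0 (b ∷ bs) ∈ b ∷ bs
max∈ b bs with argmax-sel id 0 (b ∷ bs)
... | inj₂ m∈ = m∈
... | inj₁ m≡0 = here (trans m≡0 (sym (n≤0⇒n≡0 (subst (b ≤_) m≡0 (All.head (xs≤max 0 (b ∷ bs)))))))

max-suc : ∀ s b bs → All (0 <_) (b ∷ bs) → All (_< suc s) (b ∷ bs) → Σ ℕ λ k → max 0 (b ∷ bs) ≡ suc k × k < s
max-suc s b bs pos bounded
  with max 0 (b ∷ bs) | ≤-trans (All.head pos) (All.head (xs≤max 0 (b ∷ bs))) | max<v⁺ z<s bounded
... | suc k | _ | s≤s k<s = k , refl , k<s

max-map-suc≡ᵇ : ∀ i w → All (_< suc i) w → (max 0 (map suc w) ≡ᵇ suc i) ≡ hasMax (suc i) w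
max-map-suc≡ᵇ i w w<si = reflects-≡ (≡ᵇ-reflects-≡ _ _) (any-reflects (λ x → ≡ᵇ-reflects-≡ x i) w)
  (λ max≡ → case-on-max max≡ (argmax-sel id 0 (map suc w)))
  (λ i∈w → max≈v⁺ (Any-map⁺ (Any.map (λ x≡i → cong suc (sym x≡i)) i∈w)) (All-map⁺ w<si) z≤n)
  where
  case-on-max : max 0 (map suc w) ≡ suc i → (max 0 (map suc w) ≡ 0 ⊎ max 0 (map suc w) ∈ map suc w) → Any (_≡ i) w
  case-on-max max≡ (inj₁ max≡0) = contradiction (trans (sym max≡) max≡0) (λ ())
  case-on-max max≡ (inj₂ max∈)  = Any.map (λ max≡sx → suc-injective (trans (sym max≡sx) max≡)) (Any-map⁻ max∈)

Beneath⇔Plateau : ∀ α b bs → Beneath α (b ∷ bs) ⇔ Plateau (max 0 (b ∷ bs)) α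
Beneath⇔Plateau α b bs = mk⇔
  (λ (below , no010) → All.map (max≤v⁺ z≤n) below , AllPairs.map (λ h → All.lookup h (max∈ b bs)) no010)
  (λ (m≤ , no010) → All.map (λ m≤a → All.map (λ c≤m → ≤-trans c≤m m≤a) (xs≤max 0 (b ∷ bs))) m≤ ,
     AllPairs.map (λ (m≤a , no010) → All.map (λ c≤m (a<a' , c≡a) →
                     no010 (a<a' , ≤-antisym m≤a (subst (_≤ _) c≡a c≤m))) (xs≤max 0 (b ∷ bs)))
                  (AllPairs-zipˡ m≤ no010))

Avoiding-++-0∷-positive : ∀ α b bs → All (0 <_) α → All (0 <_) (b ∷ bs) →
  Avoiding (α ++ 0 ∷ b ∷ bs) ⇔ (Avoiding α × Avoiding (b ∷ bs) × Plateau (max 0 (b ∷ bs)) α)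
Avoiding-++-0∷-positive α b bs posα posβ = mk⇔
  (λ av → let (avα , av0β , beneath) = to (Avoiding-++-0∷ α (b ∷ bs) posα) av in
          avα , to (Avoiding-0∷ _ posβ) av0β , to (Beneath⇔Plateau α b bs) beneath)
  (λ (avα , avβ , plateau) →
     from (Avoiding-++-0∷ α (b ∷ bs) posα) (avα , from (Avoiding-0∷ _ posβ) avβ , from (Beneath⇔Plateau α b bs) plateau))

avoidsBoth-+ : ∀ c σ → avoidsBoth (map (_+_ c) σ) ≡ avoidsBoth σ
avoidsBoth-+ c σ = reflects-≡ (avoidsBoth-reflects _) (avoidsBoth-reflects σ) (to (Avoiding-+ c σ)) (from (Avoiding-+ c σ))

avoidsBoth-0∷suc : ∀ x γ → avoidsBoth (0 ∷ suc x ∷ γ) ≡ positive γ ∧ avoidsBoth (suc x ∷ γ)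
avoidsBoth-0∷suc x γ = reflects-≡ (avoidsBoth-reflects _) (positive-reflects γ ×-reflects avoidsBoth-reflects _)
  (λ av → Avoiding-0∷suc⇒positive x γ av , proj₂ av)
  (λ (pos , av) → from (Avoiding-0∷ (suc x ∷ γ) (s≤s z≤n ∷ pos)) av)

avoidsBoth-++-0∷0∷ : ∀ α γ → All (0 <_) α → avoidsBoth (α ++ 0 ∷ 0 ∷ γ) ≡ avoidsBoth (α ++ 0 ∷ γ)
avoidsBoth-++-0∷0∷ α γ pos = reflects-≡ (avoidsBoth-reflects _) (avoidsBoth-reflects _)
  (to (Avoiding-++-0∷0∷ α γ pos)) (from (Avoiding-++-0∷0∷ α γ pos))

avoidsBoth-++-0∷suc : ∀ α x γ → avoidsBoth (α ++ 0 ∷ suc x ∷ γ) ≡ positive γ ∧ avoidsBoth (α ++ 0 ∷ suc x ∷ γ)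
avoidsBoth-++-0∷suc α x γ = reflects-≡ (avoidsBoth-reflects _) (positive-reflects γ ×-reflects avoidsBoth-reflects _)
  (λ av → Avoiding-0∷suc⇒positive x γ (proj₁ (proj₂ (to (Avoiding-++ α _) av))) , av) proj₂

avoidsBoth-++-[0] : ∀ α → All (0 <_) α → avoidsBoth (α ++ [ 0 ]) ≡ avoidsBoth α
avoidsBoth-++-[0] α pos = reflects-≡ (avoidsBoth-reflects _) (avoidsBoth-reflects α)
  (to (Avoiding-++-[0] α pos)) (from (Avoiding-++-[0] α pos))

avoidsBoth-++-0∷-positive : ∀ α b bs → All (0 <_) α → All (0 <_) (b ∷ bs) →
  avoidsBoth (α ++ 0 ∷ b ∷ bs) ≡ avoidsBoth α ∧ avoidsBoth (b ∷ bs) ∧ plateau (max 0 (b ∷ bs)) α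
avoidsBoth-++-0∷-positive α b bs posα posβ = reflects-≡ (avoidsBoth-reflects _)
  (avoidsBoth-reflects α ×-reflects avoidsBoth-reflects _ ×-reflects proof (plateau? _ α))
  (to (Avoiding-++-0∷-positive α b bs posα posβ)) (from (Avoiding-++-0∷-positive α b bs posα posβ))

Plateau-∷ʳ-above : ∀ m α v → m < v → Plateau m (α ++ [ v ]) ⇔ All (suc m ≤_) (α ++ [ v ])
Plateau-∷ʳ-above m α v m<v = mk⇔
  (λ pl → let ((m≤α , _) , _ , no010) = to (Plateau-∷ʳ m α v) pl in
          ++⁺ (All.zipWith (λ (m≤a , no010) → ≤∧≢⇒< m≤a (λ { refl → no010 (m<v , refl) })) (m≤α , no010)) (m<v ∷ []))
  (above⇒Plateau m (α ++ [ v ]))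

Plateau-∷ʳ-same : ∀ m α → (Avoiding (α ++ [ m ]) × Plateau m (α ++ [ m ])) ⇔ (Avoiding α × Plateau m α)
Plateau-∷ʳ-same m α = mk⇔
  (λ (av , pl) → proj₁ (to (Avoiding-++ α [ m ]) av) , proj₁ (to (Plateau-∷ʳ m α m) pl))
  (λ (av , pl) → Avoiding-∷ʳ m α pl av ,
                 from (Plateau-∷ʳ m α m) (pl , ≤-refl , All.universal (λ _ (a<m , m≡a) → <-irrefl (sym m≡a) a<m) α))

𝟙-plateau-∷ʳ : ∀ m α v →
  𝟙 (avoidsBoth (α ++ [ v ]) ∧ plateau m (α ++ [ v ])) ≡
  𝟙 (m ≡ᵇ v) * 𝟙 (avoidsBoth α ∧ plateau m α) + 𝟙 (all (suc m ≤ᵇ_) (α ++ [ v ]) ∧ avoidsBoth (α ++ [ v ]))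
𝟙-plateau-∷ʳ m α v with <-cmp m v
... | tri< m<v _ _ rewrite det (≡ᵇ-reflects-≡ m v) (ofⁿ (<⇒≢ m<v)) =
  cong 𝟙 (reflects-≡ (avoidsBoth-reflects (α ++ [ v ]) ×-reflects proof (plateau? m (α ++ [ v ])))
                     (all-reflects (≤ᵇ-reflects-≤ (suc m)) (α ++ [ v ]) ×-reflects avoidsBoth-reflects (α ++ [ v ]))
                     (λ (av , pl) → to (Plateau-∷ʳ-above m α v m<v) pl , av)
                     (λ (above , av) → av , from (Plateau-∷ʳ-above m α v m<v) above))
... | tri≈ _ refl _ rewrite det (≡ᵇ-reflects-≡ m m) (ofʸ refl)
                          | det (all-reflects (≤ᵇ-reflects-≤ (suc m)) (α ++ [ m ]))
                                (ofⁿ (λ above → <-irrefl refl (All.head (proj₂ (++⁻ α above))))) =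
  trans (cong 𝟙 (reflects-≡ (avoidsBoth-reflects (α ++ [ m ]) ×-reflects proof (plateau? m (α ++ [ m ])))
                            (avoidsBoth-reflects α ×-reflects proof (plateau? m α))
                            (to (Plateau-∷ʳ-same m α)) (from (Plateau-∷ʳ-same m α))))
        (sym (trans (+-identityʳ _) (+-identityʳ _)))
... | tri> _ _ v<m rewrite det (≡ᵇ-reflects-≡ m v) (ofⁿ (≢-sym (<⇒≢ v<m)))
                         | det (proof (plateau? m (α ++ [ v ])))
                               (ofⁿ (λ pl → <⇒≱ v<m (proj₁ (proj₂ (to (Plateau-∷ʳ m α v) pl)))))
                         | det (all-reflects (≤ᵇ-reflects-≤ (suc m)) (α ++ [ v ]))
                               (ofⁿ (λ above → <⇒≱ v<m (<⇒≤ (All.head (proj₂ (++⁻ α above)))))) =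
  cong 𝟙 (∧-zeroʳ (avoidsBoth (α ++ [ v ])))

-- Counting

∑ˢ-positive : ∀ n u → ∑ˢ n (suc u) 1 (λ σ → 𝟙 (positive σ) * 𝟙 (avoidsBoth σ)) ≡ 𝒜 n u
∑ˢ-positive n u = trans (∑ˢ-shift n 1 u 1 (𝟙 ∘ avoidsBoth)) (∑ˢ-cong n u 1 (λ σ _ _ → cong 𝟙 (avoidsBoth-+ 1 σ)))

𝒜-suc : ∀ n u → 𝒜 n (suc u) ≡ 𝒜 n u + ∑ˢ n (suc u) 1 (λ σ → 𝟙 (not (positive σ)) * 𝟙 (avoidsBoth σ))
𝒜-suc n u = begin
  𝒜 n (suc u)
    ≡⟨ ∑ˢ-cong n (suc u) 1 (λ σ _ _ → 𝟙-split (positive σ) (𝟙 (avoidsBoth σ))) ⟩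
  ∑ˢ n (suc u) 1 (λ σ → 𝟙 (positive σ) * 𝟙 (avoidsBoth σ) + 𝟙 (not (positive σ)) * 𝟙 (avoidsBoth σ))
    ≡⟨ ∑ˢ-distrib-+ n (suc u) 1 _ _ ⟩
  _ + ∑ˢ n (suc u) 1 (λ σ → 𝟙 (not (positive σ)) * 𝟙 (avoidsBoth σ))
    ≡⟨ cong (_+ ∑ˢ n (suc u) 1 (λ σ → 𝟙 (not (positive σ)) * 𝟙 (avoidsBoth σ))) (∑ˢ-positive n u) ⟩
  𝒜 n u + ∑ˢ n (suc u) 1 (λ σ → 𝟙 (not (positive σ)) * 𝟙 (avoidsBoth σ))
    ∎
  where open ≡-Reasoning

-- σ = α ++ 0 ∷ γ with α positive of length p
∑ˢ-first-zero : ∀ n u (f : List ℕ → ℕ) →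
  ∑ˢ n (suc u) 1 (λ σ → 𝟙 (not (positive σ)) * f σ) ≡
  ∑ n (λ p → ∑ˢ p (suc u) 1 (λ α → 𝟙 (positive α) * ∑ˢ (n ∸ suc p) (suc (suc u + p)) 1 (λ γ → f (α ++ 0 ∷ γ))))
∑ˢ-first-zero zero    u f = refl
∑ˢ-first-zero (suc n) u f = cong₂ _+_ zero-first (begin
  ∑ u (λ y → ∑ˢ n (suc (suc u)) 1 (λ τ → 𝟙 (not (positive τ)) * f (suc y ∷ τ)))
    ≡⟨ ∑-cong u (λ y _ → ∑ˢ-first-zero n (suc u) (f ∘ (suc y ∷_))) ⟩
  ∑ u (λ y → ∑ n (λ p → ∑ˢ p (suc (suc u)) 1 (λ α → 𝟙 (positive α) * rest p (suc y ∷ α))))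
    ≡⟨ ∑-comm u n _ ⟩
  ∑ n (λ p → ∑ u (λ y → ∑ˢ p (suc (suc u)) 1 (λ α → 𝟙 (positive α) * rest p (suc y ∷ α))))
    ≡⟨ ∑-cong n (λ p _ → cong₂ _+_ (sym (∑ˢ-zero p (suc (suc u)) 1)) refl) ⟩
  ∑ n (λ p → ∑ˢ (suc p) (suc u) 1 (λ α → 𝟙 (positive α) * rest p α))
    ≡⟨ ∑-cong n (λ p _ → cong (λ k → ∑ˢ (suc p) (suc u) 1 (λ α → 𝟙 (positive α) * ∑ˢ (n ∸ suc p) (suc k) 1
                                                                        (λ γ → f (α ++ 0 ∷ γ))))
                               (sym (+-suc (suc u) p))) ⟩
  ∑ n (λ p → ∑ˢ (suc p) (suc u) 1 (λ α → 𝟙 (positive α) * ∑ˢ (n ∸ suc p) (suc (suc u + suc p)) 1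
                                                                 (λ γ → f (α ++ 0 ∷ γ))))
    ∎)
  where
  open ≡-Reasoning
  rest : ℕ → List ℕ → ℕ
  rest p α = ∑ˢ (n ∸ suc p) (suc (suc (suc u) + p)) 1 (λ γ → f (α ++ 0 ∷ γ))
  zero-first : ∑ˢ n (suc (suc u)) 1 (λ τ → 1 * f (0 ∷ τ)) ≡ 1 * ∑ˢ n (suc (suc u + 0)) 1 (λ γ → f (0 ∷ γ))
  zero-first = trans (∑ˢ-*ˡ n (suc (suc u)) 1 1 (f ∘ (0 ∷_)))
                     (cong (λ k → 1 * ∑ˢ n (suc k) 1 (f ∘ (0 ∷_))) (sym (+-identityʳ (suc u))))

𝒵 : ℕ → ℕ → ℕ
𝒵 n u = ∑ˢ n u 1 (λ γ → 𝟙 (avoidsBoth (0 ∷ γ)))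

𝒵-suc : ∀ n u → 𝒵 (suc n) (suc u) ≡ 𝒵 n (suc (suc u)) + 𝒜 (suc n) u
𝒵-suc n u = cong₂ _+_
  (∑ˢ-cong n (suc (suc u)) 1 (λ γ _ _ → cong 𝟙 (avoidsBoth-++-0∷0∷ [] γ [])))
  (∑-cong u λ x _ → begin
    ∑ˢ n (suc (suc u)) 1 (λ γ → 𝟙 (avoidsBoth (0 ∷ suc x ∷ γ)))
      ≡⟨ ∑ˢ-cong n (suc (suc u)) 1 (λ γ _ _ → trans (cong 𝟙 (avoidsBoth-0∷suc x γ)) (𝟙-∧ (positive γ) _)) ⟩
    ∑ˢ n (1 + suc u) 1 (λ γ → 𝟙 (positive γ) * 𝟙 (avoidsBoth (suc x ∷ γ)))
      ≡⟨ ∑ˢ-shift n 1 (suc u) 1 (λ γ → 𝟙 (avoidsBoth (suc x ∷ γ))) ⟩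
    ∑ˢ n (suc u) 1 (λ γ → 𝟙 (avoidsBoth (map suc (x ∷ γ))))
      ≡⟨ ∑ˢ-cong n (suc u) 1 (λ γ _ _ → cong 𝟙 (avoidsBoth-+ 1 (x ∷ γ))) ⟩
    ∑ˢ n (suc u) 1 (λ γ → 𝟙 (avoidsBoth (x ∷ γ)))
      ∎)
  where open ≡-Reasoning

𝒵-sum : ∀ n u → 𝒵 n (suc u) ≡ ∑ (suc n) (λ z → 𝒜 (n ∸ z) (u + z))
𝒵-sum zero    u = refl
𝒵-sum (suc n) u = begin
  𝒵 (suc n) (suc u)
    ≡⟨ 𝒵-suc n u ⟩
  𝒵 n (suc (suc u)) + 𝒜 (suc n) u
    ≡⟨ cong (_+ 𝒜 (suc n) u) (𝒵-sum n (suc u)) ⟩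
  ∑ (suc n) (λ z → 𝒜 (n ∸ z) (suc u + z)) + 𝒜 (suc n) u
    ≡⟨ +-comm _ (𝒜 (suc n) u) ⟩
  𝒜 (suc n) u + ∑ (suc n) (λ z → 𝒜 (n ∸ z) (suc u + z))
    ≡⟨ cong₂ _+_ (cong (𝒜 (suc n)) (sym (+-identityʳ u))) (∑-cong (suc n) (λ z _ → cong (𝒜 (n ∸ z)) (sym (+-suc u z)))) ⟩
  ∑ (suc (suc n)) (λ z → 𝒜 (suc n ∸ z) (u + z))
    ∎
  where open ≡-Reasoning

∑ˢ-above : ∀ n m e → ∑ˢ n (suc m + e) 1 (λ σ → 𝟙 (all (suc m ≤ᵇ_) σ ∧ avoidsBoth σ)) ≡ 𝒜 n e
∑ˢ-above n m e = begin
  ∑ˢ n (suc m + e) 1 (λ σ → 𝟙 (all (suc m ≤ᵇ_) σ ∧ avoidsBoth σ))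
    ≡⟨ ∑ˢ-cong n _ 1 (λ σ _ _ → 𝟙-∧ (all (suc m ≤ᵇ_) σ) _) ⟩
  ∑ˢ n (suc m + e) 1 (λ σ → 𝟙 (all (suc m ≤ᵇ_) σ) * 𝟙 (avoidsBoth σ))
    ≡⟨ ∑ˢ-shift n (suc m) e 1 (𝟙 ∘ avoidsBoth) ⟩
  ∑ˢ n e 1 (λ σ → 𝟙 (avoidsBoth (map (_+_ (suc m)) σ)))
    ≡⟨ ∑ˢ-cong n e 1 (λ σ _ _ → cong 𝟙 (avoidsBoth-+ (suc m) σ)) ⟩
  𝒜 n e
    ∎
  where open ≡-Reasoning

-- Sequences of plateau shape at m are β ++ m⋯m with β above m.
∑ˢ-plateau : ∀ s m q → m ≤ s →
  ∑ˢ q (suc s) 1 (λ α → 𝟙 (avoidsBoth α ∧ plateau m α)) ≡ ∑ (suc q) (λ ℓ → 𝒜 ℓ (s ∸ m))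
∑ˢ-plateau s m zero    m≤s = refl
∑ˢ-plateau s m (suc q) m≤s = begin
  ∑ˢ (suc q) (suc s) 1 W
    ≡⟨ ∑ˢ-snoc q (suc s) 1 W ⟩
  ∑ˢ q (suc s) 1 (λ α → ∑ N (λ v → W (α ++ [ v ])))
    ≡⟨ ∑ˢ-cong q (suc s) 1 (λ α _ _ → begin
         ∑ N (λ v → W (α ++ [ v ]))
           ≡⟨ ∑-cong N (λ v _ → 𝟙-plateau-∷ʳ m α v) ⟩
         ∑ N (λ v → 𝟙 (m ≡ᵇ v) * W α + Y (α ++ [ v ]))
           ≡⟨ ∑-distrib-+ N _ _ ⟩
         ∑ N (λ v → 𝟙 (m ≡ᵇ v) * W α) + ∑ N (λ v → Y (α ++ [ v ]))
           ≡⟨ cong (_+ ∑ N (λ v → Y (α ++ [ v ]))) (∑-select N m (λ _ → W α) m<N) ⟩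
         W α + ∑ N (λ v → Y (α ++ [ v ]))
           ∎) ⟩
  ∑ˢ q (suc s) 1 (λ α → W α + ∑ N (λ v → Y (α ++ [ v ])))
    ≡⟨ ∑ˢ-distrib-+ q (suc s) 1 W _ ⟩
  ∑ˢ q (suc s) 1 W + ∑ˢ q (suc s) 1 (λ α → ∑ N (λ v → Y (α ++ [ v ])))
    ≡⟨ cong₂ _+_ (∑ˢ-plateau s m q m≤s) (sym (∑ˢ-snoc q (suc s) 1 Y)) ⟩
  ∑ (suc q) (λ ℓ → 𝒜 ℓ (s ∸ m)) + ∑ˢ (suc q) (suc s) 1 Y
    ≡⟨ cong (λ k → ∑ (suc q) (λ ℓ → 𝒜 ℓ (s ∸ m)) + ∑ˢ (suc q) (suc k) 1 Y) (sym (m+[n∸m]≡n m≤s)) ⟩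
  ∑ (suc q) (λ ℓ → 𝒜 ℓ (s ∸ m)) + ∑ˢ (suc q) (suc m + (s ∸ m)) 1 Y
    ≡⟨ cong (_+_ (∑ (suc q) (λ ℓ → 𝒜 ℓ (s ∸ m)))) (∑ˢ-above (suc q) m (s ∸ m)) ⟩
  ∑ (suc q) (λ ℓ → 𝒜 ℓ (s ∸ m)) + 𝒜 (suc q) (s ∸ m)
    ≡⟨ ∑-suc (suc q) (λ ℓ → 𝒜 ℓ (s ∸ m)) ⟨
  ∑ (suc (suc q)) (λ ℓ → 𝒜 ℓ (s ∸ m))
    ∎
  where
  open ≡-Reasoning
  N : ℕ
  N = q * 1 + suc s
  W Y : List ℕ → ℕ
  W α = 𝟙 (avoidsBoth α ∧ plateau m α)
  Y σ = 𝟙 (all (suc m ≤ᵇ_) σ ∧ avoidsBoth σ)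
  m<N : m < N
  m<N = ≤-trans (s≤s m≤s) (m≤n+m (suc s) (q * 1))

-- A positive word with maximum i + 1 fits the alphabet {0,…,i+1}, and lowering it by one gives a
-- word counted by 𝔟 _ (i + 1).
∑ˢ-max : ∀ r s i → i < s →
  ∑ˢ r (suc s) 0 (λ β → 𝟙 (positive β ∧ (max 0 β ≡ᵇ suc i) ∧ avoidsBoth β)) ≡ 𝔟 r (suc i)
∑ˢ-max r s i i<s = begin
  ∑ˢ r (suc s) 0 X
    ≡⟨ ∑ˢ-cong r (suc s) 0 (λ β _ _ → 𝟙-implied (X-bool β) (all (_<ᵇ suc (suc i)) β) (bounded β)) ⟩
  ∑ˢ r (suc s) 0 (λ β → 𝟙 (all (_<ᵇ suc (suc i)) β) * X β)
    ≡⟨ cong (λ k → ∑ˢ r (suc k) 0 (λ β → 𝟙 (all (_<ᵇ suc (suc i)) β) * X β)) (sym (m+[n∸m]≡n i<s)) ⟩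
  ∑ˢ r (suc (suc i) + (s ∸ suc i)) 0 (λ β → 𝟙 (all (_<ᵇ suc (suc i)) β) * X β)
    ≡⟨ ∑ˢ-restrict r (suc (suc i)) (s ∸ suc i) 0 X ⟩
  ∑ˢ r (1 + suc i) 0 X
    ≡⟨ ∑ˢ-cong r (suc (suc i)) 0 (λ β _ _ → 𝟙-∧ (positive β) _) ⟩
  ∑ˢ r (1 + suc i) 0 (λ β → 𝟙 (positive β) * 𝟙 ((max 0 β ≡ᵇ suc i) ∧ avoidsBoth β))
    ≡⟨ ∑ˢ-shift r 1 (suc i) 0 _ ⟩
  ∑ˢ r (suc i) 0 (λ w → 𝟙 ((max 0 (map suc w) ≡ᵇ suc i) ∧ avoidsBoth (map suc w)))
    ≡⟨ ∑ˢ-cong r (suc i) 0 (λ w w↓ _ → cong 𝟙 (begin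
         (max 0 (map suc w) ≡ᵇ suc i) ∧ avoidsBoth (map suc w)
           ≡⟨ cong₂ _∧_ (max-map-suc≡ᵇ i w (Staircase⇒All (suc i) w w↓)) (avoidsBoth-+ 1 w) ⟩
         hasMax (suc i) w ∧ avoidsBoth w
           ≡⟨ ∧-comm (hasMax (suc i) w) (avoidsBoth w) ⟩
         avoidsBoth w ∧ hasMax (suc i) w
           ∎)) ⟩
  ∑ˢ r (suc i) 0 (λ w → 𝟙 (avoidsBoth w ∧ hasMax (suc i) w))
    ≡⟨ 𝔟≡∑ˢ r (suc i) ⟨
  𝔟 r (suc i)
    ∎
  where
  open ≡-Reasoning
  X-bool : List ℕ → Bool
  X-bool β = positive β ∧ (max 0 β ≡ᵇ suc i) ∧ avoidsBoth β
  X : List ℕ → ℕ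
  X = 𝟙 ∘ X-bool
  bounded : ∀ β → T (X-bool β) → T (all (_<ᵇ suc (suc i)) β)
  bounded β t =
    let (_ , max≡ , _) = to (reflects⇒⇔ (positive-reflects β ×-reflects ≡ᵇ-reflects-≡ _ _ ×-reflects avoidsBoth-reflects β)) t
    in from (reflects⇒⇔ (all-reflects (λ x → <ᵇ-reflects-< x (suc (suc i))) β))
            (All.map (λ x≤max → s≤s (subst (_ ≤_) max≡ x≤max)) (xs≤max 0 β))

𝟙-after-zero-positive : ∀ s α b bs → All (0 <_) α → All (0 <_) (b ∷ bs) → All (_< suc s) (b ∷ bs) →
  𝟙 (avoidsBoth (α ++ 0 ∷ b ∷ bs)) ≡
  𝟙 (avoidsBoth α) * ∑ s (λ m → 𝟙 (plateau (suc m) α) * 𝟙 ((max 0 (b ∷ bs) ≡ᵇ suc m) ∧ avoidsBoth (b ∷ bs)))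
𝟙-after-zero-positive s α b bs posα posβ bounded with max-suc s b bs posβ bounded
... | k , max≡ , k<s = begin
  𝟙 (avoidsBoth (α ++ 0 ∷ β))
    ≡⟨ cong 𝟙 (avoidsBoth-++-0∷-positive α b bs posα posβ) ⟩
  𝟙 (avoidsBoth α ∧ avoidsBoth β ∧ plateau (max 0 β) α)
    ≡⟨ cong (λ t → 𝟙 (avoidsBoth α ∧ avoidsBoth β ∧ plateau t α)) max≡ ⟩
  𝟙 (avoidsBoth α ∧ avoidsBoth β ∧ plateau (suc k) α)
    ≡⟨ trans (𝟙-∧ (avoidsBoth α) _) (cong (_*_ (𝟙 (avoidsBoth α)))
         (trans (𝟙-∧ (avoidsBoth β) (plateau (suc k) α)) (*-comm (𝟙 (avoidsBoth β)) _))) ⟩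
  𝟙 (avoidsBoth α) * (𝟙 (plateau (suc k) α) * 𝟙 (avoidsBoth β))
    ≡⟨ cong (_*_ (𝟙 (avoidsBoth α))) (sym (∑-select s k (λ m → 𝟙 (plateau (suc m) α) * 𝟙 (avoidsBoth β)) k<s)) ⟩
  𝟙 (avoidsBoth α) * ∑ s (λ m → 𝟙 (k ≡ᵇ m) * (𝟙 (plateau (suc m) α) * 𝟙 (avoidsBoth β)))
    ≡⟨ cong (_*_ (𝟙 (avoidsBoth α))) (∑-cong s (λ m _ →
         trans (x*yz≡y*xz (𝟙 (k ≡ᵇ m)) (𝟙 (plateau (suc m) α)) (𝟙 (avoidsBoth β)))
               (cong (_*_ (𝟙 (plateau (suc m) α))) (sym (𝟙-∧ (k ≡ᵇ m) (avoidsBoth β)))))) ⟩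
  𝟙 (avoidsBoth α) * ∑ s (λ m → 𝟙 (plateau (suc m) α) * 𝟙 ((suc k ≡ᵇ suc m) ∧ avoidsBoth β))
    ≡⟨ cong (λ t → 𝟙 (avoidsBoth α) * ∑ s (λ m → 𝟙 (plateau (suc m) α) * 𝟙 ((t ≡ᵇ suc m) ∧ avoidsBoth β)))
            (sym max≡) ⟩
  𝟙 (avoidsBoth α) * ∑ s (λ m → 𝟙 (plateau (suc m) α) * 𝟙 ((max 0 β ≡ᵇ suc m) ∧ avoidsBoth β))
    ∎
  where
  open ≡-Reasoning
  β : List ℕ
  β = b ∷ bs

𝟙-after-zero : ∀ s α b bs → All (0 <_) α → All (_< suc s) (b ∷ bs) →
  𝟙 (positive (b ∷ bs)) * 𝟙 (avoidsBoth (α ++ 0 ∷ b ∷ bs)) ≡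
  𝟙 (avoidsBoth α) *
    ∑ s (λ m → 𝟙 (plateau (suc m) α) * 𝟙 (positive (b ∷ bs) ∧ (max 0 (b ∷ bs) ≡ᵇ suc m) ∧ avoidsBoth (b ∷ bs)))
𝟙-after-zero s α b bs posα bounded with positive (b ∷ bs) | positive-reflects (b ∷ bs)
... | false | _ =
  sym (trans (cong (_*_ (𝟙 (avoidsBoth α))) (trans (∑-cong s (λ m _ → *-zeroʳ (𝟙 (plateau (suc m) α)))) (∑-zero s)))
             (*-zeroʳ (𝟙 (avoidsBoth α))))
... | true | ofʸ posβ = trans (+-identityʳ _) (𝟙-after-zero-positive s α b bs posα posβ bounded)

∑ˢ-positive-tails : ∀ s α r → All (0 <_) α →
  ∑ˢ (suc r) (suc s) 0 (λ β → 𝟙 (positive β) * 𝟙 (avoidsBoth (α ++ 0 ∷ β))) ≡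
  𝟙 (avoidsBoth α) * ∑ s (λ m → 𝟙 (plateau (suc m) α) * 𝔟 (suc r) (suc m))
∑ˢ-positive-tails s α r posα = begin
  ∑ˢ (suc r) (suc s) 0 (λ β → 𝟙 (positive β) * 𝟙 (avoidsBoth (α ++ 0 ∷ β)))
    ≡⟨ ∑ˢ-cong (suc r) (suc s) 0 {f = λ β → 𝟙 (positive β) * 𝟙 (avoidsBoth (α ++ 0 ∷ β))}
               {g = λ β → 𝟙 (avoidsBoth α) * ∑ s (λ m → 𝟙 (plateau (suc m) α) * X m β)}
               (λ { (b ∷ bs) β↓ _ → 𝟙-after-zero s α b bs posα (Staircase⇒All (suc s) (b ∷ bs) β↓) }) ⟩
  ∑ˢ (suc r) (suc s) 0 (λ β → 𝟙 (avoidsBoth α) * ∑ s (λ m → 𝟙 (plateau (suc m) α) * X m β))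
    ≡⟨ ∑ˢ-*ˡ (suc r) (suc s) 0 (𝟙 (avoidsBoth α)) (λ β → ∑ s (λ m → 𝟙 (plateau (suc m) α) * X m β)) ⟩
  𝟙 (avoidsBoth α) * ∑ˢ (suc r) (suc s) 0 (λ β → ∑ s (λ m → 𝟙 (plateau (suc m) α) * X m β))
    ≡⟨ cong (_*_ (𝟙 (avoidsBoth α))) (begin
         ∑ˢ (suc r) (suc s) 0 (λ β → ∑ s (λ m → 𝟙 (plateau (suc m) α) * X m β))
           ≡⟨ ∑ˢ-∑ (suc r) (suc s) 0 s (λ m β → 𝟙 (plateau (suc m) α) * X m β) ⟩
         ∑ s (λ m → ∑ˢ (suc r) (suc s) 0 (λ β → 𝟙 (plateau (suc m) α) * X m β))
           ≡⟨ ∑-cong s (λ m m<s → trans (∑ˢ-*ˡ (suc r) (suc s) 0 (𝟙 (plateau (suc m) α)) (X m))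
                                         (cong (_*_ (𝟙 (plateau (suc m) α))) (∑ˢ-max (suc r) s m m<s))) ⟩
         ∑ s (λ m → 𝟙 (plateau (suc m) α) * 𝔟 (suc r) (suc m))
           ∎) ⟩
  𝟙 (avoidsBoth α) * ∑ s (λ m → 𝟙 (plateau (suc m) α) * 𝔟 (suc r) (suc m))
    ∎
  where
  open ≡-Reasoning
  X : ℕ → List ℕ → ℕ
  X m β = 𝟙 (positive β ∧ (max 0 β ≡ᵇ suc m) ∧ avoidsBoth β)

-- After the first zero, γ is a block of zeros followed by a positive word β, and β ≠ [] forces
-- α to be of plateau shape at max β.
∑ˢ-tails : ∀ s α L → All (0 <_) α →
  ∑ˢ L (suc s) 0 (λ γ → 𝟙 (avoidsBoth (α ++ 0 ∷ γ))) ≡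
  𝟙 (avoidsBoth α) + ∑ L (λ i → 𝟙 (avoidsBoth α) * ∑ s (λ m → 𝟙 (plateau (suc m) α) * 𝔟 (suc i) (suc m)))
∑ˢ-tails s α zero    pos = trans (cong 𝟙 (avoidsBoth-++-[0] α pos)) (sym (+-identityʳ _))
∑ˢ-tails s α (suc L) pos = begin
  ∑ˢ (suc L) (suc s) 0 (λ γ → 𝟙 (avoidsBoth (α ++ 0 ∷ γ)))
    ≡⟨ cong₂ _+_ (∑ˢ-cong L (suc s) 0 (λ γ _ _ → cong 𝟙 (avoidsBoth-++-0∷0∷ α γ pos)))
                 (∑-cong s (λ x _ → ∑ˢ-cong L (suc s) 0 (λ γ _ _ →
                    trans (cong 𝟙 (avoidsBoth-++-0∷suc α x γ)) (𝟙-∧ (positive γ) _)))) ⟩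
  ∑ˢ L (suc s) 0 (λ γ → 𝟙 (avoidsBoth (α ++ 0 ∷ γ))) + ∑ s (λ x → ∑ˢ L (suc s) 0 (λ γ → R (suc x ∷ γ)))
    ≡⟨ cong₂ _+_ (∑ˢ-tails s α L pos) (cong (_+ ∑ s (λ x → ∑ˢ L (suc s) 0 (λ γ → R (suc x ∷ γ))))
                                                  (sym (∑ˢ-zero L (suc s) 0))) ⟩
  (𝟙 (avoidsBoth α) + ∑ L term) + ∑ˢ (suc L) (suc s) 0 R
    ≡⟨ +-assoc (𝟙 (avoidsBoth α)) _ _ ⟩
  𝟙 (avoidsBoth α) + (∑ L term + ∑ˢ (suc L) (suc s) 0 R)
    ≡⟨ cong (λ t → 𝟙 (avoidsBoth α) + (∑ L term + t)) (∑ˢ-positive-tails s α L pos) ⟩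
  𝟙 (avoidsBoth α) + (∑ L term + term L)
    ≡⟨ cong (_+_ (𝟙 (avoidsBoth α))) (sym (∑-suc L term)) ⟩
  𝟙 (avoidsBoth α) + ∑ (suc L) term
    ∎
  where
  open ≡-Reasoning
  R : List ℕ → ℕ
  R β = 𝟙 (positive β) * 𝟙 (avoidsBoth (α ++ 0 ∷ β))
  term : ℕ → ℕ
  term i = 𝟙 (avoidsBoth α) * ∑ s (λ m → 𝟙 (plateau (suc m) α) * 𝔟 (suc i) (suc m))

∑ˢ-tails-alphabet : ∀ s x α L e → x < suc s → All (0 <_) (x ∷ α) →
  ∑ˢ L (suc s + e) 1 (λ γ → 𝟙 (avoidsBoth (x ∷ α ++ 0 ∷ γ))) ≡
  ∑ˢ L (suc s) 0 (λ γ → 𝟙 (avoidsBoth (x ∷ α ++ 0 ∷ γ)))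
∑ˢ-tails-alphabet s x α L e x<s pos =
  trans (∑ˢ-cong L (suc s + e) 1 (λ γ _ _ → 𝟙-implied _ (all (_<ᵇ suc s) γ) (λ t →
           from (reflects⇒⇔ (all-reflects (λ c → <ᵇ-reflects-< c (suc s)) γ))
                (All.map (λ c≤x → ≤-<-trans c≤x x<s)
                         (Avoiding-++-0∷⇒≤head x α γ pos (to (reflects⇒⇔ (avoidsBoth-reflects _)) t))))))
        (∑ˢ-restrict L (suc s) e 1 _)

∑ˢ-staircase-tails : ∀ s x α L e → x < suc s →
  𝟙 (positive (x ∷ α)) * ∑ˢ L (suc s + e) 1 (λ γ → 𝟙 (avoidsBoth (x ∷ α ++ 0 ∷ γ))) ≡
  𝟙 (positive (x ∷ α) ∧ avoidsBoth (x ∷ α)) +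
  ∑ L (λ i → ∑ s (λ m → 𝔟 (suc i) (suc m) * 𝟙 (avoidsBoth (x ∷ α) ∧ plateau (suc m) (x ∷ α))))
∑ˢ-staircase-tails s x α L e x<s with positive (x ∷ α) | positive-reflects (x ∷ α)
... | false | ofⁿ ¬pos =
  sym (trans (∑-cong L (λ i _ → ∑-cong s (λ m _ → cong (_*_ (𝔟 (suc i) (suc m))) (cong 𝟙 not-plateau))))
             (trans (∑-cong L (λ i _ → trans (∑-cong s (λ m _ → *-zeroʳ (𝔟 (suc i) (suc m)))) (∑-zero s)))
                    (∑-zero L)))
  where
  not-plateau : ∀ {m} → avoidsBoth (x ∷ α) ∧ plateau (suc m) (x ∷ α) ≡ false
  not-plateau {m} = det (avoidsBoth-reflects (x ∷ α) ×-reflects proof (plateau? (suc m) (x ∷ α)))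
                        (ofⁿ (λ (_ , pl) → ¬pos (Plateau⇒positive m (x ∷ α) pl)))
... | true | ofʸ pos = begin
  ∑ˢ L (suc s + e) 1 (λ γ → 𝟙 (avoidsBoth (x ∷ α ++ 0 ∷ γ))) + 0
    ≡⟨ +-identityʳ _ ⟩
  ∑ˢ L (suc s + e) 1 (λ γ → 𝟙 (avoidsBoth (x ∷ α ++ 0 ∷ γ)))
    ≡⟨ ∑ˢ-tails-alphabet s x α L e x<s pos ⟩
  ∑ˢ L (suc s) 0 (λ γ → 𝟙 (avoidsBoth (x ∷ α ++ 0 ∷ γ)))
    ≡⟨ ∑ˢ-tails s (x ∷ α) L pos ⟩
  𝟙 av + ∑ L (λ i → 𝟙 av * ∑ s (λ m → 𝟙 (plateau (suc m) (x ∷ α)) * 𝔟 (suc i) (suc m)))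
    ≡⟨ cong (_+_ (𝟙 av)) (∑-cong L (λ i _ →
         trans (sym (∑-*ˡ s (𝟙 av) (λ m → 𝟙 (plateau (suc m) (x ∷ α)) * 𝔟 (suc i) (suc m)))) (∑-cong s (λ m _ →
           trans (x*yz≡z*xy (𝟙 av) (𝟙 (plateau (suc m) (x ∷ α))) (𝔟 (suc i) (suc m)))
                 (cong (_*_ (𝔟 (suc i) (suc m))) (sym (𝟙-∧ av (plateau (suc m) (x ∷ α))))))))) ⟩
  𝟙 av + ∑ L (λ i → ∑ s (λ m → 𝔟 (suc i) (suc m) * 𝟙 (av ∧ plateau (suc m) (x ∷ α))))
    ∎
  where
  open ≡-Reasoning
  av : Bool
  av = avoidsBoth (x ∷ α)

∑ˢ-first-zero-at-suc : ∀ s p L →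
  ∑ˢ (suc p) (suc s) 1 (λ α → 𝟙 (positive α) * ∑ˢ L (suc (suc s + suc p)) 1 (λ γ → 𝟙 (avoidsBoth (α ++ 0 ∷ γ)))) ≡
  𝒜 (suc p) s + ∑ L (λ i → ∑ s (λ m → 𝔟 (suc i) (suc m) * ∑ (suc (suc p)) (λ ℓ → 𝒜 ℓ (s ∸ suc m))))
∑ˢ-first-zero-at-suc s p L = begin
  ∑ˢ (suc p) (suc s) 1 (λ α → 𝟙 (positive α) * ∑ˢ L (suc (suc s + suc p)) 1 (λ γ → 𝟙 (avoidsBoth (α ++ 0 ∷ γ))))
    ≡⟨ ∑ˢ-cong (suc p) (suc s) 1 {f = λ α → 𝟙 (positive α) * ∑ˢ L (suc (suc s + suc p)) 1 (λ γ → 𝟙 (avoidsBoth (α ++ 0 ∷ γ)))}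
                                 {g = λ α → 𝟙 (positive α ∧ avoidsBoth α) + H α}
                                 (λ { (x ∷ α) (x<s , _) _ →
         trans (cong (λ k → 𝟙 (positive (x ∷ α)) * ∑ˢ L k 1 (λ γ → 𝟙 (avoidsBoth (x ∷ α ++ 0 ∷ γ))))
                     (cong suc (sym (+-suc s (suc p)))))
               (∑ˢ-staircase-tails s x α L (suc (suc p)) x<s) }) ⟩
  ∑ˢ (suc p) (suc s) 1 (λ α → 𝟙 (positive α ∧ avoidsBoth α) + ∑ L (λ i → ∑ s (λ m → 𝔟 (suc i) (suc m) * W m α)))
    ≡⟨ ∑ˢ-distrib-+ (suc p) (suc s) 1 (λ α → 𝟙 (positive α ∧ avoidsBoth α)) H ⟩
  ∑ˢ (suc p) (suc s) 1 (λ α → 𝟙 (positive α ∧ avoidsBoth α)) +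
  ∑ˢ (suc p) (suc s) 1 (λ α → ∑ L (λ i → ∑ s (λ m → 𝔟 (suc i) (suc m) * W m α)))
    ≡⟨ cong₂ _+_
         (trans (∑ˢ-cong (suc p) (suc s) 1 (λ α _ _ → 𝟙-∧ (positive α) (avoidsBoth α))) (∑ˢ-positive (suc p) s))
         (trans (∑ˢ-∑ (suc p) (suc s) 1 L (λ i α → ∑ s (λ m → 𝔟 (suc i) (suc m) * W m α))) (∑-cong L (λ i _ →
            trans (∑ˢ-∑ (suc p) (suc s) 1 s (λ m α → 𝔟 (suc i) (suc m) * W m α)) (∑-cong s (λ m m<s →
              trans (∑ˢ-*ˡ (suc p) (suc s) 1 (𝔟 (suc i) (suc m)) (W m))
                    (cong (_*_ (𝔟 (suc i) (suc m))) (∑ˢ-plateau s (suc m) (suc p) m<s))))))) ⟩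
  𝒜 (suc p) s + ∑ L (λ i → ∑ s (λ m → 𝔟 (suc i) (suc m) * ∑ (suc (suc p)) (λ ℓ → 𝒜 ℓ (s ∸ suc m))))
    ∎
  where
  open ≡-Reasoning
  W : ℕ → List ℕ → ℕ
  W m α = 𝟙 (avoidsBoth α ∧ plateau (suc m) α)
  H : List ℕ → ℕ
  H α = ∑ L (λ i → ∑ s (λ m → 𝔟 (suc i) (suc m) * W m α))

𝒜-recurrence : ∀ n s → let N = suc n in 𝒜 N (suc s) ≡
  ∑ (suc N) (λ z → 𝒜 (N ∸ z) (s + z)) + ∑ (N ∸ 1) (λ i → 𝒜 (N ∸ suc i) s) +
  ∑ (N ∸ 2) (λ r → ∑ s (λ m → 𝔟 (suc r) (suc m) *
    ∑ (suc (N ∸ suc r ∸ 1)) (λ ℓ → (N ∸ suc r ∸ ℓ ∸ δ ℓ 0) * 𝒜 ℓ (s ∸ suc m))))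
𝒜-recurrence n s = begin
  𝒜 (suc n) (suc s)
    ≡⟨ 𝒜-suc (suc n) s ⟩
  𝒜 (suc n) s + ∑ˢ (suc n) (suc s) 1 (λ σ → 𝟙 (not (positive σ)) * 𝟙 (avoidsBoth σ))
    ≡⟨ cong (_+_ (𝒜 (suc n) s)) (∑ˢ-first-zero (suc n) s (𝟙 ∘ avoidsBoth)) ⟩
  𝒜 (suc n) s + (1 * 𝒵 n (suc (suc s + 0)) + ∑ n (λ q → ∑ˢ (suc q) (suc s) 1 (λ α → 𝟙 (positive α) *
                    ∑ˢ (n ∸ suc q) (suc (suc s + suc q)) 1 (λ γ → 𝟙 (avoidsBoth (α ++ 0 ∷ γ))))))
    ≡⟨ cong (_+_ (𝒜 (suc n) s)) (cong₂ _+_ zero-first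
         (trans (∑-cong n (λ q _ → ∑ˢ-first-zero-at-suc s q (n ∸ suc q))) (∑-distrib-+ n (λ q → 𝒜 (suc q) s) E))) ⟩
  𝒜 (suc n) s + (∑ (suc n) (λ z → 𝒜 (n ∸ z) (s + suc z)) + (∑ n (λ q → 𝒜 (suc q) s) + ∑ n E))
    ≡⟨ regroup (𝒜 (suc n) s) _ _ _ ⟩
  (𝒜 (suc n) s + ∑ (suc n) (λ z → 𝒜 (n ∸ z) (s + suc z))) + ∑ n (λ q → 𝒜 (suc q) s) + ∑ n E
    ≡⟨ cong₂ _+_ (cong₂ _+_ (cong (λ t → 𝒜 (suc n) t + ∑ (suc n) (λ z → 𝒜 (n ∸ z) (s + suc z))) (sym (+-identityʳ s)))
                             (sym (∑-reverse′ n (λ k → 𝒜 k s))))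
                 (∑-reindex n s (λ i m → 𝔟 (suc i) (suc m)) (λ m ℓ → 𝒜 ℓ (s ∸ suc m))) ⟩
  ∑ (suc (suc n)) (λ z → 𝒜 (suc n ∸ z) (s + z)) + ∑ n (λ i → 𝒜 (n ∸ i) s) +
  ∑ (n ∸ 1) (λ r → ∑ s (λ m → 𝔟 (suc r) (suc m) *
    ∑ (suc (n ∸ r ∸ 1)) (λ ℓ → (n ∸ r ∸ ℓ ∸ δ ℓ 0) * 𝒜 ℓ (s ∸ suc m))))
    ∎
  where
  open ≡-Reasoning
  E : ℕ → ℕ
  E q = ∑ (n ∸ suc q) (λ i → ∑ s (λ m → 𝔟 (suc i) (suc m) * ∑ (suc (suc q)) (λ ℓ → 𝒜 ℓ (s ∸ suc m))))
  regroup : ∀ a z b c → a + (z + (b + c)) ≡ (a + z) + b + c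
  regroup = solve-∀
  zero-first : 1 * 𝒵 n (suc (suc s + 0)) ≡ ∑ (suc n) (λ z → 𝒜 (n ∸ z) (s + suc z))
  zero-first = begin
    1 * 𝒵 n (suc (suc s + 0))                    ≡⟨ *-identityˡ _ ⟩
    𝒵 n (suc (suc s + 0))                        ≡⟨ cong (λ t → 𝒵 n (suc t)) (+-identityʳ (suc s)) ⟩
    𝒵 n (suc (suc s))                            ≡⟨ 𝒵-sum n (suc s) ⟩
    ∑ (suc n) (λ z → 𝒜 (n ∸ z) (suc s + z))      ≡⟨ ∑-cong (suc n) (λ z _ → cong (𝒜 (n ∸ z)) (sym (+-suc s z))) ⟩
    ∑ (suc n) (λ z → 𝒜 (n ∸ z) (s + suc z))      ∎

first-sum : ∀ n s →
  sumFT 0 n (λ z → 𝔞 (n ∸ z) ((+ s) ℤ.+ (+ z) ℤ.- (+ 1))) ≡ ∑ (suc n) (λ z → 𝒜 (n ∸ z) (s + z))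
first-sum n s = trans (sumFT-∑ 0 n (λ z → 𝔞 (n ∸ z) ((+ s) ℤ.+ (+ z) ℤ.- (+ 1)))) (∑-cong (suc n) λ z _ →
  𝔞≡𝒜 (n ∸ z) (s + z) (cong (ℤ._- (+ 1)) (sym (ℤₚ.pos-+ s z))))

second-sum : ∀ n s → sumFT 1 (n ∸ 1) (λ z → 𝔞 (n ∸ z) ((+ s) ℤ.- (+ 1))) ≡ ∑ (n ∸ 1) (λ i → 𝒜 (n ∸ suc i) s)
second-sum n s = trans (sumFT-∑ 1 (n ∸ 1) (λ z → 𝔞 (n ∸ z) ((+ s) ℤ.- (+ 1))))
                       (∑-cong (n ∸ 1) λ i _ → 𝔞≡𝒜 (n ∸ suc i) s refl)

third-sum : ∀ n s →
  sumFT 1 (n ∸ 2) (λ r → sumFT 1 s (λ m → 𝔟 r m *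
    sumFT 0 (n ∸ r ∸ 1) (λ ℓ → (n ∸ r ∸ ℓ ∸ δ ℓ 0) * 𝔞 ℓ ((+ s) ℤ.- (+ m) ℤ.- (+ 1))))) ≡
  ∑ (n ∸ 2) (λ r → ∑ s (λ m → 𝔟 (suc r) (suc m) *
    ∑ (suc (n ∸ suc r ∸ 1)) (λ ℓ → (n ∸ suc r ∸ ℓ ∸ δ ℓ 0) * 𝒜 ℓ (s ∸ suc m))))
third-sum n s = trans (sumFT-∑ 1 (n ∸ 2) _) (∑-cong (n ∸ 2) λ r _ →
  trans (sumFT-∑ 1 s _) (∑-cong s λ m m<s → cong (_*_ (𝔟 (suc r) (suc m)))
    (trans (sumFT-∑ 0 (n ∸ suc r ∸ 1) _) (∑-cong (suc (n ∸ suc r ∸ 1)) λ ℓ _ → cong (_*_ (n ∸ suc r ∸ ℓ ∸ δ ℓ 0))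
      (𝔞≡𝒜 ℓ (s ∸ suc m) (cong (ℤ._- (+ 1)) (trans (ℤₚ.[+m]-[+n]≡m⊖n s (suc m)) (ℤₚ.⊖-≥ m<s))))))))

theorem22 : (n s : ℕ) → n ≥ 1 →
    𝔞 n (+ s) ≡
      sumFT 0 n (λ z → 𝔞 (n ∸ z) ((+ s) ℤ.+ (+ z) ℤ.- (+ 1)))
      + sumFT 1 (n ∸ 1) (λ z → 𝔞 (n ∸ z) ((+ s) ℤ.- (+ 1)))
      + sumFT 1 (n ∸ 2) (λ r → sumFT 1 s (λ m → 𝔟 r m *
          sumFT 0 (n ∸ r ∸ 1) (λ ℓ → (n ∸ r ∸ ℓ ∸ δ ℓ 0) * 𝔞 ℓ ((+ s) ℤ.- (+ m) ℤ.- (+ 1)))))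
theorem22 (suc n) s _ = begin
  𝔞 (suc n) (+ s)    ≡⟨ 𝔞≡𝒜 (suc n) (suc s) (sym (ℤₚ.[+m]-[+n]≡m⊖n (suc s) 1)) ⟩
  𝒜 (suc n) (suc s)  ≡⟨ 𝒜-recurrence n s ⟩
  _                  ≡⟨ cong₂ _+_ (cong₂ _+_ (first-sum (suc n) s) (second-sum (suc n) s)) (third-sum (suc n) s) ⟨
  _                  ∎
  where open ≡-Reasoning
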